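{- Let $n\geqslant 1$ and $1\leqslant d\leqslant n-1$ be integers. Then \begin{align*} &\sum_{k=1}^{n-1}q^k\begin{bmatrix}2k\\ k+d\end{bmatrix}\frac{(-q^{k+1};q)_{n-k}}{[k]}\\ &\quad=-\sum_{k=1}^{\lfloor(n+1-d)/2\rfloor}(-1)^kq^{3k^2+(3d-5)k-2d+2}\frac{[2d+4k-2]}{[d][n]}\begin{bmatrix}2n\\ n-d-2k+1\end{bmatrix}, \end{align*} and \begin{align*} \sum_{k=1}^{n}q^k\begin{bmatrix}2k\\ k+d\end{bmatrix}\frac{(-q^{k+1};q)_{n-k}^2}{[k]} =\sum_{k=d}^{n-1}q^{\binom{k+1}{2}-\binom{d}{2}}\frac{1}{[d]}\begin{bmatrix}2n+1\\ n-k\end{bmatrix}+\frac{q^{\binom{n+1}{2}-\binom{d}{2}}}{[d]}. \end{align*}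
   Context: For an indeterminate $q$: $[m]=\frac{1-q^m}{1-q}=1+q+\cdots+q^{m-1}$; $(x;q)_0=1$ and $(x;q)_m=(1-x)(1-xq)\cdots(1-xq^{m-1})$ for $m\geq 1$. The $q$-binomial coefficient is $\begin{bmatrix}N\\ k\end{bmatrix}=\frac{(q;q)_N}{(q;q)_k(q;q)_{N-k}}$ if $0\leqslant k\leqslant N$ and $0$ otherwise. $\lfloor x\rfloor$ is the largest integer $\leq x$. These are identities of rational functions in $q$. -}

module Defs where

open import Data.Nat as ℕ using (ℕ; zero; suc)
open import Data.Rational using (ℚ; 0ℚ; 1ℚ; _+_; _*_; _-_; -_; _÷_; ≢-nonZero)
open import Data.Rational.Properties using (_≟_)
open import Relation.Nullary using (yes; no)

infixr 8 _^_
_^_ : ℚ → ℕ → ℚ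
x ^ zero = 1ℚ
x ^ suc m = x * (x ^ m)

-- total division: x ⊘ 0 = 0 (only ever used with nonzero denominators
-- under the hypotheses q ≢ 1, q ≢ -1 of the theorem)
infixl 7 _⊘_
_⊘_ : ℚ → ℚ → ℚ
x ⊘ y with y ≟ 0ℚ
... | yes _ = 0ℚ
... | no y≢0 = _÷_ x y {{≢-nonZero y≢0}}

-- Σ_{k=a}^{b} f k  (empty, i.e. 0, if b < a): sum of f (a + i) for i < b + 1 - a
sumFrom : ℕ → ℕ → (ℕ → ℚ) → ℚ
sumFrom a zero f = 0ℚ
sumFrom a (suc m) f = f a + sumFrom (suc a) m f

Σ[_to_] : ℕ → ℕ → (ℕ → ℚ) → ℚ
Σ[ a to b ] f = sumFrom a (suc b ℕ.∸ a) f

qint : ℚ → ℕ → ℚ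
qint q zero = 0ℚ
qint q (suc m) = q ^ m + qint q m

qpoch : ℚ → ℚ → ℕ → ℚ
qpoch x q zero = 1ℚ
qpoch x q (suc m) = qpoch x q m * (1ℚ - x * q ^ m)

qbinom : ℚ → ℕ → ℕ → ℚ
qbinom q N k with k ℕ.≤? N
... | yes _ = qpoch q q N ⊘ (qpoch q q k * qpoch q q (N ℕ.∸ k))
... | no _ = 0ℚ

{-# OPTIONS --safe #-}
module Submission where

-- Both identities are proved by induction on n, starting at n = d (n = d - 1 for the second),
-- where both sides vanish because the q-binomial [2k, k+d] is 0 for k < d. Passing from n to n + 1 multiplies
-- every summand on the left by 1 + q^(n+1) (by its square in the second identity) and adds
-- one summand; the right-hand sides, multiplied by suitable q-integers, obey the same
-- recurrence because each of their terms satisfies a contiguous relation for central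
-- q-binomial coefficients whose inhomogeneous part telescopes in the summation index.
-- The contiguous relations are identities of rational functions in q, verified by clearing
-- the q-factorial denominators.

open import Defs
open import Data.Nat as ℕ using (ℕ; suc; _≤_; _∸_; _/_)
open import Data.Nat.Combinatorics using (_C_)
open import Data.Rational using (ℚ; 1ℚ; _+_; _*_; -_)
open import Data.Product using (_×_)
open import Relation.Binary.PropositionalEquality using (_≡_; _≢_)

open import Data.Nat using (zero; _<_; z≤n; s≤s)
import Data.Nat.Properties as ℕP
open import Data.Nat.Tactic.RingSolver using (solve)
open import Data.Nat.Combinatorics using (nCk+nC[k+1]≡[n+1]C[k+1]; nC1≡n)
open import Data.Nat.DivMod using (m/n*n≤m; m≡m%n+[m/n]*n; m%n<n; m/n≤m)
open import Data.Rational using (0ℚ; _-_; 1/_; ∣_∣; NonNegative; ≢-nonZero)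
import Data.Rational as ℚ using (_<_; _≤_)
import Data.Rational.Properties as ℚP
open import Data.Product using (_,_)
open import Data.Sum using (inj₁; inj₂)
open import Data.Empty using (⊥-elim)
open import Data.List using (_∷_; [])
open import Data.Maybe using (Maybe; just; nothing)
open import Relation.Nullary using (yes; no)
open import Relation.Binary.Definitions using (tri<; tri≈; tri>)
open import Relation.Binary.PropositionalEquality using (refl; sym; trans; cong; cong₂; subst; module ≡-Reasoning)
open import Tactic.RingSolver using (solve-∀)
open import Tactic.RingSolver.Core.AlmostCommutativeRing using (AlmostCommutativeRing; fromCommutativeRing)

ℚ-zero? : (x : ℚ) → Maybe (0ℚ ≡ x)
ℚ-zero? x with 0ℚ ℚP.≟ x
... | yes p = just p
... | no _ = nothing

ℚ-ring : AlmostCommutativeRing _ _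
ℚ-ring = fromCommutativeRing ℚP.+-*-commutativeRing ℚ-zero?

half-gap-< : ∀ {m d t} → d ≤ m → t < (m ∸ d) / 2 → d ℕ.+ 2 ℕ.* suc t ≤ m
half-gap-< {m} {d} {t} d≤m t<u = begin
  d ℕ.+ 2 ℕ.* suc t        ≤⟨ ℕP.+-monoʳ-≤ d (ℕP.*-monoʳ-≤ 2 t<u) ⟩
  d ℕ.+ 2 ℕ.* (w / 2)      ≤⟨ ℕP.+-monoʳ-≤ d (subst (_≤ w) (ℕP.*-comm (w / 2) 2) (m/n*n≤m w 2)) ⟩
  d ℕ.+ w                  ≡⟨ ℕP.m+[n∸m]≡n d≤m ⟩
  m                        ∎
  where open ℕP.≤-Reasoning
        w = m ∸ d

half-gap-≥ : ∀ {m d t} → d ≤ m → (m ∸ d) / 2 ≤ t → m ≤ suc (d ℕ.+ 2 ℕ.* t)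
half-gap-≥ {m} {d} {t} d≤m u≤t = begin
  m                              ≡⟨ ℕP.m+[n∸m]≡n d≤m ⟨
  d ℕ.+ w                        ≡⟨ cong (d ℕ.+_) (m≡m%n+[m/n]*n w 2) ⟩
  d ℕ.+ (w ℕ.% 2 ℕ.+ w / 2 ℕ.* 2)  ≤⟨ ℕP.+-monoʳ-≤ d (ℕP.+-mono-≤ (ℕP.≤-pred (m%n<n w 2)) (ℕP.*-monoˡ-≤ 2 u≤t)) ⟩
  d ℕ.+ (1 ℕ.+ t ℕ.* 2)          ≡⟨ solve (d ∷ t ∷ []) ⟩
  suc (d ℕ.+ 2 ℕ.* t)            ∎
  where open ℕP.≤-Reasoning
        w = m ∸ d

[2+k]C2≡[1+k]C2+[1+k] : ∀ k → suc (suc k) C 2 ≡ suc k C 2 ℕ.+ suc k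
[2+k]C2≡[1+k]C2+[1+k] k = begin
  suc (suc k) C 2            ≡⟨ nCk+nC[k+1]≡[n+1]C[k+1] (suc k) 1 ⟨
  suc k C 1 ℕ.+ suc k C 2    ≡⟨ cong (ℕ._+ suc k C 2) (nC1≡n (suc k)) ⟩
  suc k ℕ.+ suc k C 2        ≡⟨ ℕP.+-comm (suc k) _ ⟩
  suc k C 2 ℕ.+ suc k        ∎
  where open ≡-Reasoning

[1+k]C2-mono : ∀ {a b} → a ≤ b → suc a C 2 ≤ suc b C 2
[1+k]C2-mono a≤b = go (ℕP.≤⇒≤′ a≤b)
  where
  go : ∀ {a b} → a ℕ.≤′ b → suc a C 2 ≤ suc b C 2
  go ℕ.≤′-refl         = ℕP.≤-refl
  go (ℕ.≤′-step {b} h) = ℕP.≤-trans (go h) (ℕP.≤-trans (ℕP.m≤m+n _ (suc b)) (ℕP.≤-reflexive (sym ([2+k]C2≡[1+k]C2+[1+k] b))))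

open ≡-Reasoning

cong₃ : ∀ {A B C D : Set} (f : A → B → C → D) {x x′ y y′ z z′} →
        x ≡ x′ → y ≡ y′ → z ≡ z′ → f x y z ≡ f x′ y′ z′
cong₃ f refl refl refl = refl

*-cancelˡ : ∀ {a x y} → a ≢ 0ℚ → a * x ≡ a * y → x ≡ y
*-cancelˡ {a} {x} {y} a≢0 ax≡ay = begin
  x              ≡⟨ sym (ℚP.*-identityˡ x) ⟩
  1ℚ * x         ≡⟨ cong (_* x) (sym (ℚP.*-inverseˡ a {{≢-nonZero a≢0}})) ⟩
  (a⁻¹ * a) * x  ≡⟨ ℚP.*-assoc a⁻¹ a x ⟩
  a⁻¹ * (a * x)  ≡⟨ cong (a⁻¹ *_) ax≡ay ⟩
  a⁻¹ * (a * y)  ≡⟨ sym (ℚP.*-assoc a⁻¹ a y) ⟩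
  (a⁻¹ * a) * y  ≡⟨ cong (_* y) (ℚP.*-inverseˡ a {{≢-nonZero a≢0}}) ⟩
  1ℚ * y         ≡⟨ ℚP.*-identityˡ y ⟩
  y              ∎
  where a⁻¹ = (1/ a) {{≢-nonZero a≢0}}

*-≢0 : ∀ {a b} → a ≢ 0ℚ → b ≢ 0ℚ → a * b ≢ 0ℚ
*-≢0 {a} a≢0 b≢0 ab≡0 = b≢0 (*-cancelˡ a≢0 (trans ab≡0 (sym (ℚP.*-zeroʳ a))))

x-y≡0⇒x≡y : ∀ {x y} → x - y ≡ 0ℚ → x ≡ y
x-y≡0⇒x≡y {x} {y} x-y≡0 = begin
  x           ≡⟨ sym (restore x y) ⟩
  x - y + y   ≡⟨ cong (_+ y) x-y≡0 ⟩
  0ℚ + y      ≡⟨ ℚP.+-identityˡ y ⟩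
  y           ∎
  where restore : ∀ a b → a - b + b ≡ a
        restore = solve-∀ ℚ-ring

⊘-*-cancelʳ : ∀ x {y} → y ≢ 0ℚ → (x ⊘ y) * y ≡ x
⊘-*-cancelʳ x {y} y≢0 with y ℚP.≟ 0ℚ
... | yes y≡0 = ⊥-elim (y≢0 y≡0)
... | no _ = begin
  (x * y⁻¹) * y  ≡⟨ ℚP.*-assoc x y⁻¹ y ⟩
  x * (y⁻¹ * y)  ≡⟨ cong (x *_) (ℚP.*-inverseˡ y {{≢-nonZero y≢0}}) ⟩
  x * 1ℚ         ≡⟨ ℚP.*-identityʳ x ⟩
  x              ∎
  where y⁻¹ = (1/ y) {{≢-nonZero y≢0}}

⊘-unique : ∀ {x y z} → y ≢ 0ℚ → z * y ≡ x → x ⊘ y ≡ z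
⊘-unique {x} {y} {z} y≢0 zy≡x = *-cancelˡ y≢0 (begin
  y * (x ⊘ y)  ≡⟨ ℚP.*-comm y _ ⟩
  (x ⊘ y) * y  ≡⟨ ⊘-*-cancelʳ x y≢0 ⟩
  x            ≡⟨ sym zy≡x ⟩
  z * y        ≡⟨ ℚP.*-comm z y ⟩
  y * z        ∎)

⊘-*-comm : ∀ x y z → (x ⊘ y) * z ≡ (x * z) ⊘ y
⊘-*-comm x y z with y ℚP.≟ 0ℚ
... | yes _ = ℚP.*-zeroˡ z
... | no y≢0 = swap x ((1/ y) {{≢-nonZero y≢0}}) z
  where swap : ∀ a b c → a * b * c ≡ a * c * b
        swap = solve-∀ ℚ-ring

*-zeroʳ-≡ : ∀ x {y} → y ≡ 0ℚ → x * y ≡ 0ℚ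
*-zeroʳ-≡ x refl = ℚP.*-zeroʳ x

0⊘x≡0 : ∀ x → 0ℚ ⊘ x ≡ 0ℚ
0⊘x≡0 x with x ℚP.≟ 0ℚ
... | yes _ = refl
... | no x≢0 = ℚP.*-zeroˡ ((1/ x) {{≢-nonZero x≢0}})

^-+ : ∀ x m n → x ^ (m ℕ.+ n) ≡ x ^ m * x ^ n
^-+ x zero    n = sym (ℚP.*-identityˡ _)
^-+ x (suc m) n = trans (cong (x *_) (^-+ x m n)) (sym (ℚP.*-assoc x _ _))

^-* : ∀ x m n → x ^ (m ℕ.* n) ≡ (x ^ n) ^ m
^-* x zero    n = refl
^-* x (suc m) n = trans (^-+ x n (m ℕ.* n)) (cong (x ^ n *_) (^-* x m n))

sumFrom-snoc : ∀ a m (f : ℕ → ℚ) → sumFrom a (suc m) f ≡ sumFrom a m f + f (a ℕ.+ m)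
sumFrom-snoc a zero f = begin
  f a + 0ℚ          ≡⟨ ℚP.+-comm (f a) 0ℚ ⟩
  0ℚ + f a          ≡⟨ cong (λ k → 0ℚ + f k) (sym (ℕP.+-identityʳ a)) ⟩
  0ℚ + f (a ℕ.+ 0)  ∎
sumFrom-snoc a (suc m) f = begin
  f a + sumFrom (suc a) (suc m) f                 ≡⟨ cong (f a +_) (sumFrom-snoc (suc a) m f) ⟩
  f a + (sumFrom (suc a) m f + f (suc a ℕ.+ m))   ≡⟨ sym (ℚP.+-assoc (f a) _ _) ⟩
  f a + sumFrom (suc a) m f + f (suc a ℕ.+ m)     ≡⟨ cong (λ k → f a + sumFrom (suc a) m f + f k) (sym (ℕP.+-suc a m)) ⟩
  f a + sumFrom (suc a) m f + f (a ℕ.+ suc m)     ∎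

sumFrom-shift : ∀ a m (f : ℕ → ℚ) → sumFrom (suc a) m f ≡ sumFrom a m (λ k → f (suc k))
sumFrom-shift a zero    f = refl
sumFrom-shift a (suc m) f = cong (f (suc a) +_) (sumFrom-shift (suc a) m f)

sumFrom-cong : ∀ a m {f g : ℕ → ℚ} → (∀ k → a ≤ k → k < a ℕ.+ m → f k ≡ g k) →
               sumFrom a m f ≡ sumFrom a m g
sumFrom-cong a zero    f≗g = refl
sumFrom-cong a (suc m) f≗g = cong₂ _+_ (f≗g a ℕP.≤-refl (ℕP.m<m+n a (s≤s z≤n)))
  (sumFrom-cong (suc a) m λ k a<k k<a+1+m → f≗g k (ℕP.<⇒≤ a<k) (subst (k <_) (sym (ℕP.+-suc a m)) k<a+1+m))

sumFrom-*ˡ : ∀ a m (f : ℕ → ℚ) c → sumFrom a m (λ k → c * f k) ≡ c * sumFrom a m f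
sumFrom-*ˡ a zero    f c = sym (ℚP.*-zeroʳ c)
sumFrom-*ˡ a (suc m) f c = trans (cong (c * f a +_) (sumFrom-*ˡ (suc a) m f c)) (sym (ℚP.*-distribˡ-+ c _ _))

sumFrom-*ʳ : ∀ a m (f : ℕ → ℚ) c → sumFrom a m (λ k → f k * c) ≡ sumFrom a m f * c
sumFrom-*ʳ a m f c = begin
  sumFrom a m (λ k → f k * c)  ≡⟨ sumFrom-cong a m (λ k _ _ → ℚP.*-comm (f k) c) ⟩
  sumFrom a m (λ k → c * f k)  ≡⟨ sumFrom-*ˡ a m f c ⟩
  c * sumFrom a m f            ≡⟨ ℚP.*-comm c _ ⟩
  sumFrom a m f * c            ∎

sumFrom-+ : ∀ a m (f g : ℕ → ℚ) → sumFrom a m (λ k → f k + g k) ≡ sumFrom a m f + sumFrom a m g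
sumFrom-+ a zero    f g = sym (ℚP.+-identityʳ 0ℚ)
sumFrom-+ a (suc m) f g = trans (cong (f a + g a +_) (sumFrom-+ (suc a) m f g)) (interchange (f a) (g a) _ _)
  where interchange : ∀ x y u v → x + y + (u + v) ≡ x + u + (y + v)
        interchange = solve-∀ ℚ-ring

sumFrom-neg : ∀ a m (f : ℕ → ℚ) → sumFrom a m (λ k → - f k) ≡ - sumFrom a m f
sumFrom-neg a zero    f = refl
sumFrom-neg a (suc m) f = trans (cong (- f a +_) (sumFrom-neg (suc a) m f)) (sym (ℚP.neg-distrib-+ (f a) _))

sumFrom-telescope : ∀ a m (G : ℕ → ℚ) → sumFrom a m (λ k → G k - G (suc k)) ≡ G a - G (a ℕ.+ m)
sumFrom-telescope a zero    G = trans (sym (ℚP.+-inverseʳ (G a))) (cong (λ k → G a - G k) (sym (ℕP.+-identityʳ a)))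
sumFrom-telescope a (suc m) G = begin
  G a - G (suc a) + sumFrom (suc a) m (λ k → G k - G (suc k))  ≡⟨ cong (G a - G (suc a) +_) (sumFrom-telescope (suc a) m G) ⟩
  G a - G (suc a) + (G (suc a) - G (suc a ℕ.+ m))              ≡⟨ collapse (G a) (G (suc a)) _ ⟩
  G a - G (suc a ℕ.+ m)                                        ≡⟨ cong (λ k → G a - G k) (sym (ℕP.+-suc a m)) ⟩
  G a - G (a ℕ.+ suc m)                                        ∎
  where collapse : ∀ x y z → x - y + (y - z) ≡ x - z
        collapse = solve-∀ ℚ-ring

sumFrom-zero : ∀ a m (f : ℕ → ℚ) → (∀ k → a ≤ k → k < a ℕ.+ m → f k ≡ 0ℚ) → sumFrom a m f ≡ 0ℚ
sumFrom-zero a m f f≡0 = trans (sumFrom-cong a m f≡0) (zeros a m)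
  where zeros : ∀ a m → sumFrom a m (λ _ → 0ℚ) ≡ 0ℚ
        zeros a zero    = refl
        zeros a (suc m) = trans (ℚP.+-identityˡ _) (zeros (suc a) m)

sumFrom-pad : ∀ a m e (f : ℕ → ℚ) → (∀ k → a ℕ.+ m ≤ k → f k ≡ 0ℚ) → sumFrom a (m ℕ.+ e) f ≡ sumFrom a m f
sumFrom-pad a zero    e f f≡0 = sumFrom-zero a e f λ k a≤k _ → f≡0 k (subst (_≤ k) (sym (ℕP.+-identityʳ a)) a≤k)
sumFrom-pad a (suc m) e f f≡0 = cong (f a +_) (sumFrom-pad (suc a) m e f λ k le → f≡0 k (subst (_≤ k) (sym (ℕP.+-suc a m)) le))

module Gaussian (q : ℚ) where

  qfact : ℕ → ℚ
  qfact = qpoch q q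

  gauss : ℕ → ℕ → ℚ
  gauss N       zero    = 1ℚ
  gauss zero    (suc k) = 0ℚ
  gauss (suc N) (suc k) = gauss N k + q ^ suc k * gauss N (suc k)

  gauss-2n : ℕ → ℕ → ℚ
  gauss-2n N k = gauss (N ℕ.+ N) (N ℕ.+ k)

  gauss-2n+1 : ℕ → ℕ → ℚ
  gauss-2n+1 N k = gauss (suc (N ℕ.+ N)) (N ℕ.+ k)

  gauss-above : ∀ N k → N < k → gauss N k ≡ 0ℚ
  gauss-above zero    (suc k) _         = refl
  gauss-above (suc N) (suc k) (s≤s N<k) = begin
    gauss N k + q ^ suc k * gauss N (suc k)  ≡⟨ cong₂ (λ x y → x + q ^ suc k * y) (gauss-above N k N<k)
                                                      (gauss-above N (suc k) (ℕP.m≤n⇒m≤1+n N<k)) ⟩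
    0ℚ + q ^ suc k * 0ℚ                      ≡⟨ zero-sum (q ^ suc k) ⟩
    0ℚ                                       ∎
    where zero-sum : ∀ c → 0ℚ + c * 0ℚ ≡ 0ℚ
          zero-sum = solve-∀ ℚ-ring

  qbinom-above : ∀ N k → N < k → qbinom q N k ≡ 0ℚ
  qbinom-above N k N<k with k ℕ.≤? N
  ... | yes k≤N = ⊥-elim (ℕP.<⇒≱ N<k k≤N)
  ... | no  _   = refl

  gauss-diag : ∀ N → gauss N N ≡ 1ℚ
  gauss-diag zero    = refl
  gauss-diag (suc N) = begin
    gauss N N + q ^ suc N * gauss N (suc N)  ≡⟨ cong₂ (λ x y → x + q ^ suc N * y) (gauss-diag N) (gauss-above N (suc N) ℕP.≤-refl) ⟩
    1ℚ + q ^ suc N * 0ℚ                      ≡⟨ one-sum (q ^ suc N) ⟩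
    1ℚ                                       ∎
    where one-sum : ∀ c → 1ℚ + c * 0ℚ ≡ 1ℚ
          one-sum = solve-∀ ℚ-ring

  gauss-factorial : ∀ a b → gauss (a ℕ.+ b) a * qfact a * qfact b ≡ qfact (a ℕ.+ b)
  gauss-factorial zero b = unit (qfact b)
    where unit : ∀ y → 1ℚ * 1ℚ * y ≡ y
          unit = solve-∀ ℚ-ring
  gauss-factorial (suc a) zero rewrite ℕP.+-identityʳ a =
    trans (cong (λ g → g * qfact (suc a) * 1ℚ) (gauss-diag (suc a))) (unit (qfact (suc a)))
    where unit : ∀ y → 1ℚ * y * 1ℚ ≡ y
          unit = solve-∀ ℚ-ring
  gauss-factorial (suc a) (suc b) rewrite ℕP.+-suc a b =
    trans (pascal-step (gauss (suc (a ℕ.+ b)) a) (gauss (suc (a ℕ.+ b)) (suc a)) (qfact a) (qfact b) (qfact (suc (a ℕ.+ b)))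
                       (q ^ a) (q ^ b) left right)
          (cong (λ z → qfact (suc (a ℕ.+ b)) * (1ℚ - q * z)) (sym (cong (q *_) (^-+ q a b))))
    where
    left : gauss (suc (a ℕ.+ b)) a * qfact a * qfact (suc b) ≡ qfact (suc (a ℕ.+ b))
    left = subst (λ N → gauss N a * qfact a * qfact (suc b) ≡ qfact N) (ℕP.+-suc a b) (gauss-factorial a (suc b))
    right : gauss (suc (a ℕ.+ b)) (suc a) * qfact (suc a) * qfact b ≡ qfact (suc (a ℕ.+ b))
    right = gauss-factorial (suc a) b
    pascal-step : ∀ g₁ g₂ A B K u v → g₁ * A * (B * (1ℚ - q * v)) ≡ K → g₂ * (A * (1ℚ - q * u)) * B ≡ K →
                  (g₁ + q * u * g₂) * (A * (1ℚ - q * u)) * (B * (1ℚ - q * v)) ≡ K * (1ℚ - q * (q * (u * v)))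
    pascal-step g₁ g₂ A B K u v e₁ e₂ = begin
      (g₁ + q * u * g₂) * (A * (1ℚ - q * u)) * (B * (1ℚ - q * v))
        ≡⟨ expand g₁ g₂ A B q u v ⟩
      (1ℚ - q * u) * (g₁ * A * (B * (1ℚ - q * v))) + q * u * (1ℚ - q * v) * (g₂ * (A * (1ℚ - q * u)) * B)
        ≡⟨ cong₂ (λ s t → (1ℚ - q * u) * s + q * u * (1ℚ - q * v) * t) e₁ e₂ ⟩
      (1ℚ - q * u) * K + q * u * (1ℚ - q * v) * K
        ≡⟨ collect K q u v ⟩
      K * (1ℚ - q * (q * (u * v)))
        ∎
      where
      expand : ∀ g₁ g₂ A B x u v → (g₁ + x * u * g₂) * (A * (1ℚ - x * u)) * (B * (1ℚ - x * v))
               ≡ (1ℚ - x * u) * (g₁ * A * (B * (1ℚ - x * v))) + x * u * (1ℚ - x * v) * (g₂ * (A * (1ℚ - x * u)) * B)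
      expand = solve-∀ ℚ-ring
      collect : ∀ K x u v → (1ℚ - x * u) * K + x * u * (1ℚ - x * v) * K ≡ K * (1ℚ - x * (x * (u * v)))
      collect = solve-∀ ℚ-ring

  gauss-factorial-at : ∀ a b N k N′ → a ℕ.+ b ≡ N → a ≡ k → a ℕ.+ b ≡ N′ →
                       gauss N k * qfact a * qfact b ≡ qfact N′
  gauss-factorial-at a b _ _ _ refl refl refl = gauss-factorial a b

  qint-closed : ∀ m → (1ℚ - q) * qint q m ≡ 1ℚ - q ^ m
  qint-closed zero    = cancel q
    where cancel : ∀ x → (1ℚ - x) * 0ℚ ≡ 1ℚ - 1ℚ
          cancel = solve-∀ ℚ-ring
  qint-closed (suc m) = begin
    (1ℚ - q) * (q ^ m + qint q m)          ≡⟨ distrib q (q ^ m) (qint q m) ⟩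
    (1ℚ - q) * q ^ m + (1ℚ - q) * qint q m ≡⟨ cong ((1ℚ - q) * q ^ m +_) (qint-closed m) ⟩
    (1ℚ - q) * q ^ m + (1ℚ - q ^ m)        ≡⟨ telescope q (q ^ m) ⟩
    1ℚ - q * q ^ m                         ∎
    where distrib : ∀ x y I → (1ℚ - x) * (y + I) ≡ (1ℚ - x) * y + (1ℚ - x) * I
          distrib = solve-∀ ℚ-ring
          telescope : ∀ x y → (1ℚ - x) * y + (1ℚ - y) ≡ 1ℚ - x * y
          telescope = solve-∀ ℚ-ring

  qint-suc : ∀ m → qint q (suc m) ≡ 1ℚ + q * qint q m
  qint-suc zero    = unit q
    where unit : ∀ x → 1ℚ + 0ℚ ≡ 1ℚ + x * 0ℚ
          unit = solve-∀ ℚ-ring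
  qint-suc (suc m) = trans (cong (q * q ^ m +_) (qint-suc m)) (regroup q (q ^ m) (qint q m))
    where regroup : ∀ x y I → x * y + (1ℚ + x * I) ≡ 1ℚ + x * (y + I)
          regroup = solve-∀ ℚ-ring

  monomial : ∀ e i s a b c → e ≡ a ℕ.* i ℕ.+ b ℕ.* s ℕ.+ c → q ^ e ≡ (q ^ i) ^ a * (q ^ s) ^ b * q ^ c
  monomial _ i s a b c refl = trans (^-+ q (a ℕ.* i ℕ.+ b ℕ.* s) c)
    (cong (_* q ^ c) (trans (^-+ q (a ℕ.* i) (b ℕ.* s)) (cong₂ _*_ (^-* q a i) (^-* q b s))))

module NonDegenerate (q : ℚ) (q≢1 : q ≢ 1ℚ) (q≢-1 : q ≢ - 1ℚ) where

  open Gaussian q public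

  private
    p : ℚ
    p = ∣ q ∣

    instance
      p-nonNeg : NonNegative p
      p-nonNeg = ℚP.∣-∣-nonNeg q

    ∣q^m∣ : ∀ m → ∣ q ^ m ∣ ≡ p ^ m
    ∣q^m∣ zero    = refl
    ∣q^m∣ (suc m) = trans (ℚP.∣p*q∣≡∣p∣*∣q∣ q (q ^ m)) (cong (p *_) (∣q^m∣ m))

    p^m≤1 : p ℚ.< 1ℚ → ∀ m → p ^ m ℚ.≤ 1ℚ
    p^m≤1 p<1 zero    = ℚP.≤-refl
    p^m≤1 p<1 (suc m) = ℚP.≤-trans (ℚP.*-monoˡ-≤-nonNeg p (p^m≤1 p<1 m))
                                   (ℚP.≤-trans (ℚP.≤-reflexive (ℚP.*-identityʳ p)) (ℚP.<⇒≤ p<1))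

    1≤p^m : 1ℚ ℚ.< p → ∀ m → 1ℚ ℚ.≤ p ^ m
    1≤p^m 1<p zero    = ℚP.≤-refl
    1≤p^m 1<p (suc m) = ℚP.≤-trans (ℚP.<⇒≤ 1<p)
      (ℚP.≤-trans (ℚP.≤-reflexive (sym (ℚP.*-identityʳ p))) (ℚP.*-monoˡ-≤-nonNeg p (1≤p^m 1<p m)))

    ∣q∣≢1 : p ≢ 1ℚ
    ∣q∣≢1 p≡1 with ℚP.∣p∣≡p∨∣p∣≡-p q
    ... | inj₁ ∣q∣≡q  = q≢1 (trans (sym ∣q∣≡q) p≡1)
    ... | inj₂ ∣q∣≡-q = q≢-1 (ℚP.neg-injective (trans (sym ∣q∣≡-q) p≡1))

    p^suc≢1 : ∀ m → p ^ suc m ≢ 1ℚ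
    p^suc≢1 m p^m+1≡1 with ℚP.<-cmp p 1ℚ
    ... | tri< p<1 _ _ = ℚP.<-irrefl p^m+1≡1
          (ℚP.≤-<-trans (ℚP.*-monoˡ-≤-nonNeg p (p^m≤1 p<1 m)) (ℚP.≤-<-trans (ℚP.≤-reflexive (ℚP.*-identityʳ p)) p<1))
    ... | tri≈ _ p≡1 _ = ∣q∣≢1 p≡1
    ... | tri> _ _ 1<p = ℚP.<-irrefl (sym p^m+1≡1)
          (ℚP.<-≤-trans 1<p (ℚP.≤-trans (ℚP.≤-reflexive (sym (ℚP.*-identityʳ p))) (ℚP.*-monoˡ-≤-nonNeg p (1≤p^m 1<p m))))

  q^suc≢1 : ∀ m → q ^ suc m ≢ 1ℚ
  q^suc≢1 m q^m+1≡1 = p^suc≢1 m (trans (sym (∣q^m∣ (suc m))) (cong ∣_∣ q^m+1≡1))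

  1-q^suc≢0 : ∀ m → 1ℚ - q ^ suc m ≢ 0ℚ
  1-q^suc≢0 m 1-q^m+1≡0 = q^suc≢1 m (sym (x-y≡0⇒x≡y 1-q^m+1≡0))

  1-q≢0 : 1ℚ - q ≢ 0ℚ
  1-q≢0 1-q≡0 = q≢1 (sym (x-y≡0⇒x≡y 1-q≡0))

  qint≢0 : ∀ m → qint q (suc m) ≢ 0ℚ
  qint≢0 m [m+1]≡0 = 1-q^suc≢0 m (begin
    1ℚ - q ^ suc m             ≡⟨ sym (qint-closed (suc m)) ⟩
    (1ℚ - q) * qint q (suc m)  ≡⟨ cong ((1ℚ - q) *_) [m+1]≡0 ⟩
    (1ℚ - q) * 0ℚ              ≡⟨ ℚP.*-zeroʳ (1ℚ - q) ⟩
    0ℚ                         ∎)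

  qfact≢0 : ∀ m → qfact m ≢ 0ℚ
  qfact≢0 zero    = λ ()
  qfact≢0 (suc m) = *-≢0 (qfact≢0 m) (1-q^suc≢0 m)

  qbinom≡gauss : ∀ N k → qbinom q N k ≡ gauss N k
  qbinom≡gauss N k with k ℕ.≤? N
  ... | yes k≤N = ⊘-unique (*-≢0 (qfact≢0 k) (qfact≢0 (N ∸ k)))
                           (trans (sym (ℚP.*-assoc (gauss N k) (qfact k) (qfact (N ∸ k)))) factorial)
    where factorial : gauss N k * qfact k * qfact (N ∸ k) ≡ qfact N
          factorial = gauss-factorial-at k (N ∸ k) N k N (ℕP.m+[n∸m]≡n k≤N) refl (ℕP.m+[n∸m]≡n k≤N)
  ... | no  k≰N = sym (gauss-above N k (ℕP.≰⇒> k≰N))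

  gauss-sym : ∀ a b → gauss (a ℕ.+ b) a ≡ gauss (a ℕ.+ b) b
  gauss-sym a b = *-cancelˡ (*-≢0 (qfact≢0 a) (qfact≢0 b)) (begin
    qfact a * qfact b * gauss (a ℕ.+ b) a  ≡⟨ rotate (gauss (a ℕ.+ b) a) (qfact a) (qfact b) ⟩
    gauss (a ℕ.+ b) a * qfact a * qfact b  ≡⟨ gauss-factorial a b ⟩
    qfact (a ℕ.+ b)                        ≡⟨ sym (gauss-factorial-at b a (a ℕ.+ b) b (a ℕ.+ b) (ℕP.+-comm b a) refl (ℕP.+-comm b a)) ⟩
    gauss (a ℕ.+ b) b * qfact b * qfact a  ≡⟨ rotate′ (gauss (a ℕ.+ b) b) (qfact a) (qfact b) ⟩
    qfact a * qfact b * gauss (a ℕ.+ b) b  ∎)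
    where rotate : ∀ g x y → x * y * g ≡ g * x * y
          rotate = solve-∀ ℚ-ring
          rotate′ : ∀ g x y → g * y * x ≡ x * y * g
          rotate′ = solve-∀ ℚ-ring

  gauss-pred : ∀ N → gauss (suc N) N ≡ qint q (suc N)
  gauss-pred N = *-cancelˡ (*-≢0 (qfact≢0 N) 1-q≢0) (begin
    qfact N * (1ℚ - q) * gauss (suc N) N          ≡⟨ regroup (gauss (suc N) N) (qfact N) q ⟩
    gauss (suc N) N * qfact N * qfact 1           ≡⟨ gauss-factorial-at N 1 (suc N) N (suc N) (ℕP.+-comm N 1) refl (ℕP.+-comm N 1) ⟩
    qfact (suc N)                                 ≡⟨ cong (qfact N *_) (sym (qint-closed (suc N))) ⟩
    qfact N * ((1ℚ - q) * qint q (suc N))         ≡⟨ sym (ℚP.*-assoc (qfact N) (1ℚ - q) _) ⟩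
    qfact N * (1ℚ - q) * qint q (suc N)           ∎)
    where regroup : ∀ g Q x → Q * (1ℚ - x) * g ≡ g * Q * (1ℚ * (1ℚ - x * 1ℚ))
          regroup = solve-∀ ℚ-ring

  qint-double : ∀ m → qint q m * (1ℚ + q ^ m) ≡ qint q (m ℕ.+ m)
  qint-double m = *-cancelˡ 1-q≢0 (begin
    (1ℚ - q) * (qint q m * (1ℚ + q ^ m))  ≡⟨ sym (ℚP.*-assoc (1ℚ - q) (qint q m) _) ⟩
    (1ℚ - q) * qint q m * (1ℚ + q ^ m)    ≡⟨ cong (_* (1ℚ + q ^ m)) (qint-closed m) ⟩
    (1ℚ - q ^ m) * (1ℚ + q ^ m)           ≡⟨ difference-of-squares (q ^ m) ⟩
    1ℚ - q ^ m * q ^ m                    ≡⟨ cong (λ x → 1ℚ - x) (sym (^-+ q m m)) ⟩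
    1ℚ - q ^ (m ℕ.+ m)                    ≡⟨ sym (qint-closed (m ℕ.+ m)) ⟩
    (1ℚ - q) * qint q (m ℕ.+ m)           ∎)
    where difference-of-squares : ∀ x → (1ℚ - x) * (1ℚ + x) ≡ 1ℚ - x * x
          difference-of-squares = solve-∀ ℚ-ring

  1/[1-q] : ℚ
  1/[1-q] = (1/ (1ℚ - q)) {{≢-nonZero 1-q≢0}}

  qint≡ : ∀ m → qint q m ≡ (1ℚ - q ^ m) * 1/[1-q]
  qint≡ m = *-cancelˡ 1-q≢0 (begin
    (1ℚ - q) * qint q m                  ≡⟨ qint-closed m ⟩
    1ℚ - q ^ m                           ≡⟨ sym (ℚP.*-identityʳ _) ⟩
    (1ℚ - q ^ m) * 1ℚ                    ≡⟨ cong ((1ℚ - q ^ m) *_) (sym (ℚP.*-inverseʳ (1ℚ - q) {{≢-nonZero 1-q≢0}})) ⟩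
    (1ℚ - q ^ m) * ((1ℚ - q) * 1/[1-q])  ≡⟨ swap (1ℚ - q) (1ℚ - q ^ m) 1/[1-q] ⟩
    (1ℚ - q) * ((1ℚ - q ^ m) * 1/[1-q])  ∎)
    where swap : ∀ a b c → b * (a * c) ≡ a * (b * c)
          swap = solve-∀ ℚ-ring

-- Each gᵢ is a numerator over a sub-product of the common denominator; multiplying
-- the claimed relation by that denominator leaves a relation between numerators.
combine-fractions₃ : ∀ A B u₁ u₂ u₃ u₄ M R g₁ g₂ g₃ g₄ a₁ a₂ a₃ a₄ →
  g₁ * (A * u₁ * u₂) * (B * u₃ * u₄) ≡ R →
  g₂ * (A * u₁) * (B * u₃) ≡ M →
  g₃ * A * (B * u₃ * u₄) ≡ M →
  g₄ * (A * u₁ * u₂) * B ≡ M →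
  (A * u₁ * u₂) * (B * u₃ * u₄) ≢ 0ℚ →
  a₁ * R ≡ a₂ * (u₂ * u₄ * M) + a₃ * (u₁ * u₂ * M) + a₄ * (u₃ * u₄ * M) →
  a₁ * g₁ ≡ a₂ * g₂ + a₃ * g₃ + a₄ * g₄
combine-fractions₃ A B u₁ u₂ u₃ u₄ M R g₁ g₂ g₃ g₄ a₁ a₂ a₃ a₄ e₁ e₂ e₃ e₄ K≢0 numerators = *-cancelˡ K≢0 (begin
  (A * u₁ * u₂) * (B * u₃ * u₄) * (a₁ * g₁)
    ≡⟨ extract₁ A B u₁ u₂ u₃ u₄ g₁ a₁ ⟩
  a₁ * (g₁ * (A * u₁ * u₂) * (B * u₃ * u₄))
    ≡⟨ cong (a₁ *_) e₁ ⟩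
  a₁ * R
    ≡⟨ numerators ⟩
  a₂ * (u₂ * u₄ * M) + a₃ * (u₁ * u₂ * M) + a₄ * (u₃ * u₄ * M)
    ≡⟨ cong₃ (λ x y z → a₂ * (u₂ * u₄ * x) + a₃ * (u₁ * u₂ * y) + a₄ * (u₃ * u₄ * z)) (sym e₂) (sym e₃) (sym e₄) ⟩
  a₂ * (u₂ * u₄ * (g₂ * (A * u₁) * (B * u₃))) + a₃ * (u₁ * u₂ * (g₃ * A * (B * u₃ * u₄)))
    + a₄ * (u₃ * u₄ * (g₄ * (A * u₁ * u₂) * B))
    ≡⟨ extract₃ A B u₁ u₂ u₃ u₄ g₂ g₃ g₄ a₂ a₃ a₄ ⟩
  (A * u₁ * u₂) * (B * u₃ * u₄) * (a₂ * g₂ + a₃ * g₃ + a₄ * g₄)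
    ∎)
  where
  extract₁ : ∀ A B u₁ u₂ u₃ u₄ g₁ a₁ →
             (A * u₁ * u₂) * (B * u₃ * u₄) * (a₁ * g₁) ≡ a₁ * (g₁ * (A * u₁ * u₂) * (B * u₃ * u₄))
  extract₁ = solve-∀ ℚ-ring
  extract₃ : ∀ A B u₁ u₂ u₃ u₄ g₂ g₃ g₄ a₂ a₃ a₄ →
             a₂ * (u₂ * u₄ * (g₂ * (A * u₁) * (B * u₃))) + a₃ * (u₁ * u₂ * (g₃ * A * (B * u₃ * u₄)))
               + a₄ * (u₃ * u₄ * (g₄ * (A * u₁ * u₂) * B))
             ≡ (A * u₁ * u₂) * (B * u₃ * u₄) * (a₂ * g₂ + a₃ * g₃ + a₄ * g₄)
  extract₃ = solve-∀ ℚ-ring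

combine-fractions₂ : ∀ A B u₁ u₃ M R g₁ g₂ g₃ a₁ a₂ a₃ →
  g₁ * A * (B * u₃) ≡ M →
  g₂ * (A * u₁) * B ≡ M →
  g₃ * (A * u₁) * (B * u₃) ≡ R →
  (A * u₁) * (B * u₃) ≢ 0ℚ →
  a₁ * (u₁ * M) ≡ a₂ * (u₃ * M) + a₃ * R →
  a₁ * g₁ ≡ a₂ * g₂ + a₃ * g₃
combine-fractions₂ A B u₁ u₃ M R g₁ g₂ g₃ a₁ a₂ a₃ e₁ e₂ e₃ K≢0 numerators = *-cancelˡ K≢0 (begin
  (A * u₁) * (B * u₃) * (a₁ * g₁)
    ≡⟨ extract₁ A B u₁ u₃ g₁ a₁ ⟩
  a₁ * (u₁ * (g₁ * A * (B * u₃)))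
    ≡⟨ cong (λ x → a₁ * (u₁ * x)) e₁ ⟩
  a₁ * (u₁ * M)
    ≡⟨ numerators ⟩
  a₂ * (u₃ * M) + a₃ * R
    ≡⟨ cong₂ (λ x y → a₂ * (u₃ * x) + a₃ * y) (sym e₂) (sym e₃) ⟩
  a₂ * (u₃ * (g₂ * (A * u₁) * B)) + a₃ * (g₃ * (A * u₁) * (B * u₃))
    ≡⟨ extract₂ A B u₁ u₃ g₂ g₃ a₂ a₃ ⟩
  (A * u₁) * (B * u₃) * (a₂ * g₂ + a₃ * g₃)
    ∎)
  where
  extract₁ : ∀ A B u₁ u₃ g₁ a₁ → (A * u₁) * (B * u₃) * (a₁ * g₁) ≡ a₁ * (u₁ * (g₁ * A * (B * u₃)))
  extract₁ = solve-∀ ℚ-ring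
  extract₂ : ∀ A B u₁ u₃ g₂ g₃ a₂ a₃ →
             a₂ * (u₃ * (g₂ * (A * u₁) * B)) + a₃ * (g₃ * (A * u₁) * (B * u₃)) ≡ (A * u₁) * (B * u₃) * (a₂ * g₂ + a₃ * g₃)
  extract₂ = solve-∀ ℚ-ring

module Recurrences (q : ℚ) (q≢1 : q ≢ 1ℚ) (q≢-1 : q ≢ - 1ℚ) where

  open NonDegenerate q q≢1 q≢-1 public

  gauss-2n-above : ∀ n {k} → n < k → gauss-2n n k ≡ 0ℚ
  gauss-2n-above n n<k = gauss-above _ _ (ℕP.+-monoʳ-< n n<k)

  gauss-2n-diag : ∀ n → gauss-2n n n ≡ 1ℚ
  gauss-2n-diag n = gauss-diag (n ℕ.+ n)

  gauss-2n-pred : ∀ n → gauss-2n (suc n) n ≡ qint q (suc n ℕ.+ suc n)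
  gauss-2n-pred n = subst (λ N → gauss N (suc n ℕ.+ n) ≡ qint q N) (sym (ℕP.+-suc (suc n) n)) (gauss-pred (suc n ℕ.+ n))

  gauss-2n+1-above : ∀ n {k} → suc n < k → gauss-2n+1 n k ≡ 0ℚ
  gauss-2n+1-above n {k} n+1<k = gauss-above _ _ (subst (_< n ℕ.+ k) (ℕP.+-suc n n) (ℕP.+-monoʳ-< n n+1<k))

  gauss-2n+1-diag : ∀ n → gauss-2n+1 n (suc n) ≡ 1ℚ
  gauss-2n+1-diag n = subst (λ k → gauss (suc (n ℕ.+ n)) k ≡ 1ℚ) (sym (ℕP.+-suc n n)) (gauss-diag (suc (n ℕ.+ n)))

  gauss-2n+1-pred : ∀ n → gauss-2n+1 n n ≡ qint q (suc (n ℕ.+ n))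
  gauss-2n+1-pred n = gauss-pred (n ℕ.+ n)

  -- The hypotheses rewrite every power of q as a monomial in X = q ^ i, Y = q ^ s and q,
  -- and every q-integer [m] as (1 - q ^ m) v with v = 1/(1-q); what remains is a
  -- polynomial identity.
  private
    recurrence-numerators-2n : ∀ X Y v M {Pn P2j P2n2 Pi Pi2 Pr Pb P₁ P₂ P₃ P₄ P₅ P₆ In I2j I2n2 Ii Ii2} →
      Pn ≡ X ^ 1 * Y ^ 1 * q ^ 2 → P2j ≡ X ^ 2 * Y ^ 0 * q ^ 2 → P2n2 ≡ X ^ 2 * Y ^ 2 * q ^ 6 →
      Pi ≡ X ^ 1 * Y ^ 0 * q ^ 0 → Pi2 ≡ X ^ 1 * Y ^ 0 * q ^ 2 → Pr ≡ X ^ 0 * Y ^ 1 * q ^ 2 →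
      Pb ≡ X ^ 3 * Y ^ 1 * q ^ 4 → P₁ ≡ X ^ 2 * Y ^ 1 * q ^ 2 → P₂ ≡ X ^ 2 * Y ^ 1 * q ^ 3 →
      P₃ ≡ X ^ 0 * Y ^ 1 * q ^ 0 → P₄ ≡ X ^ 0 * Y ^ 1 * q ^ 1 → P₅ ≡ X ^ 2 * Y ^ 2 * q ^ 4 →
      P₆ ≡ X ^ 2 * Y ^ 2 * q ^ 5 →
      In ≡ (1ℚ - Pn) * v → I2j ≡ (1ℚ - P2j) * v → I2n2 ≡ (1ℚ - P2n2) * v →
      Ii ≡ (1ℚ - Pi) * v → Ii2 ≡ (1ℚ - Pi2) * v →
      (In * I2j) * (M * (1ℚ - q * P₅) * (1ℚ - q * P₆))
      ≡ (I2n2 * I2j) * ((1ℚ - q * P₂) * (1ℚ - q * P₄) * M) + (I2n2 * (Pr * Ii)) * ((1ℚ - q * P₁) * (1ℚ - q * P₂) * M)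
        + (I2n2 * (Pb * Ii2)) * ((1ℚ - q * P₃) * (1ℚ - q * P₄) * M)
    recurrence-numerators-2n X Y v M refl refl refl refl refl refl refl refl refl refl refl refl refl refl refl refl refl refl =
      identity q X Y v M
      where
      identity : ∀ q X Y v M →
        let X¹ = X * 1ℚ; X² = X * X¹; X³ = X * X²; Y¹ = Y * 1ℚ; Y² = Y * Y¹
            q¹ = q * 1ℚ; q² = q * q¹; q³ = q * q²; q⁴ = q * q³; q⁵ = q * q⁴; q⁶ = q * q⁵
            Pn = X¹ * Y¹ * q²; P2j = X² * 1ℚ * q²; P2n2 = X² * Y² * q⁶; Pi = X¹ * 1ℚ * 1ℚ
            Pi2 = X¹ * 1ℚ * q²; Pr = 1ℚ * Y¹ * q²; Pb = X³ * Y¹ * q⁴; P₁ = X² * Y¹ * q²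
            P₂ = X² * Y¹ * q³; P₃ = 1ℚ * Y¹ * 1ℚ; P₄ = 1ℚ * Y¹ * q¹; P₅ = X² * Y² * q⁴
            P₆ = X² * Y² * q⁵
            In = (1ℚ - Pn) * v; I2j = (1ℚ - P2j) * v; I2n2 = (1ℚ - P2n2) * v
            Ii = (1ℚ - Pi) * v; Ii2 = (1ℚ - Pi2) * v
        in (In * I2j) * (M * (1ℚ - q * P₅) * (1ℚ - q * P₆))
          ≡ (I2n2 * I2j) * ((1ℚ - q * P₂) * (1ℚ - q * P₄) * M) + (I2n2 * (Pr * Ii)) * ((1ℚ - q * P₁) * (1ℚ - q * P₂) * M)
            + (I2n2 * (Pb * Ii2)) * ((1ℚ - q * P₃) * (1ℚ - q * P₄) * M)
      identity = solve-∀ ℚ-ring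

  gauss-2n-recurrence : ∀ i r → let n = i ℕ.+ r in
    qint q n * (qint q (suc i ℕ.+ suc i) * gauss-2n (suc n) (suc i))
    ≡ qint q (suc n ℕ.+ suc n) * (qint q (suc i ℕ.+ suc i) * gauss-2n n (suc i)
        + q ^ r * (qint q i * gauss-2n n i)
        + q ^ suc (suc (i ℕ.+ i ℕ.+ i ℕ.+ r)) * (qint q (suc (suc i)) * gauss-2n n (suc (suc i))))
  gauss-2n-recurrence i zero rewrite ℕP.+-identityʳ i = begin
    qint q i * ([2i+2] * gauss-2n (suc i) (suc i))
      ≡⟨ cong (λ g → qint q i * ([2i+2] * g)) (gauss-2n-diag (suc i)) ⟩
    qint q i * ([2i+2] * 1ℚ)
      ≡⟨ boundary (qint q i) [2i+2] (qint q (suc (suc i))) q^[3i+2] ⟩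
    [2i+2] * ([2i+2] * 0ℚ + 1ℚ * (qint q i * 1ℚ) + q^[3i+2] * (qint q (suc (suc i)) * 0ℚ))
      ≡⟨ cong₃ (λ x y z → [2i+2] * ([2i+2] * x + 1ℚ * (qint q i * y) + q^[3i+2] * (qint q (suc (suc i)) * z)))
               (sym (gauss-2n-above i (ℕP.n<1+n i))) (sym (gauss-2n-diag i))
               (sym (gauss-2n-above i (ℕP.m<n⇒m<1+n (ℕP.n<1+n i)))) ⟩
    [2i+2] * ([2i+2] * gauss-2n i (suc i) + 1ℚ * (qint q i * gauss-2n i i) + q^[3i+2] * (qint q (suc (suc i)) * gauss-2n i (suc (suc i))))
      ∎
    where
    [2i+2] = qint q (suc i ℕ.+ suc i)
    q^[3i+2] = q ^ suc (suc (i ℕ.+ i ℕ.+ i ℕ.+ 0))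
    boundary : ∀ a b c p → a * (b * 1ℚ) ≡ b * (b * 0ℚ + 1ℚ * (a * 1ℚ) + p * (c * 0ℚ))
    boundary = solve-∀ ℚ-ring
  gauss-2n-recurrence i (suc zero) rewrite ℕP.+-comm i 1 = begin
    qint q (suc i) * ([2i+2] * gauss-2n (suc (suc i)) (suc i))
      ≡⟨ cong₂ (λ x g → x * ([2i+2] * g)) (qint-suc i) (gauss-2n-pred (suc i)) ⟩
    (1ℚ + q * qint q i) * ([2i+2] * [2i+4])
      ≡⟨ boundary q (qint q i) [2i+2] [2i+4] (qint q (suc (suc i))) q^[3i+3] ⟩
    [2i+4] * ([2i+2] * 1ℚ + (q * 1ℚ) * (qint q i * [2i+2]) + q^[3i+3] * (qint q (suc (suc i)) * 0ℚ))
      ≡⟨ cong₃ (λ x y z → [2i+4] * ([2i+2] * x + (q * 1ℚ) * (qint q i * y) + q^[3i+3] * (qint q (suc (suc i)) * z)))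
               (sym (gauss-2n-diag (suc i))) (sym (gauss-2n-pred i)) (sym (gauss-2n-above (suc i) (ℕP.n<1+n (suc i)))) ⟩
    [2i+4] * ([2i+2] * gauss-2n (suc i) (suc i) + (q * 1ℚ) * (qint q i * gauss-2n (suc i) i)
          + q^[3i+3] * (qint q (suc (suc i)) * gauss-2n (suc i) (suc (suc i))))
      ∎
    where
    [2i+2] = qint q (suc i ℕ.+ suc i)
    [2i+4] = qint q (suc (suc i) ℕ.+ suc (suc i))
    q^[3i+3] = q ^ suc (suc (i ℕ.+ i ℕ.+ i ℕ.+ 1))
    boundary : ∀ x a b c d p → (1ℚ + x * a) * (b * c) ≡ c * (b * 1ℚ + (x * 1ℚ) * (a * b) + p * (d * 0ℚ))
    boundary = solve-∀ ℚ-ring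
  -- `let` rather than `where`: the ring solver sees through `let`-bound abbreviations
  -- but treats `where`-bound ones as atoms.
  gauss-2n-recurrence i (suc (suc s)) =
    let n = i ℕ.+ suc (suc s)
        a = 2 ℕ.* i ℕ.+ s ℕ.+ 2
        c = 2 ℕ.* i ℕ.+ 2 ℕ.* s ℕ.+ 4
        [n] = qint q n
        [2i+2] = qint q (suc i ℕ.+ suc i)
        [2n+2] = qint q (suc n ℕ.+ suc n)
        [i] = qint q i
        [i+2] = qint q (suc (suc i))
        q^r = q ^ suc (suc s)
        q^[3i+r+2] = q ^ suc (suc (i ℕ.+ i ℕ.+ i ℕ.+ suc (suc s)))
        g₁ = gauss-2n (suc n) (suc i)
        g₂ = gauss-2n n (suc i)
        g₃ = gauss-2n n i
        g₄ = gauss-2n n (suc (suc i))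
        u : ℕ → ℚ
        u m = 1ℚ - q * q ^ m
        relation : ([n] * [2i+2]) * g₁ ≡ ([2n+2] * [2i+2]) * g₂ + ([2n+2] * (q^r * [i])) * g₃ + ([2n+2] * (q^[3i+r+2] * [i+2])) * g₄
        relation = combine-fractions₃ (qfact a) (qfact s) (u a) (u (suc a)) (u s) (u (suc s)) (qfact c) (qfact (suc (suc c)))
          g₁ g₂ g₃ g₄ ([n] * [2i+2]) ([2n+2] * [2i+2]) ([2n+2] * (q^r * [i])) ([2n+2] * (q^[3i+r+2] * [i+2]))
          (gauss-factorial-at (suc (suc a)) (suc (suc s)) (suc n ℕ.+ suc n) (suc n ℕ.+ suc i) (suc (suc c))
             (solve (i ∷ s ∷ [])) (solve (i ∷ s ∷ [])) (solve (i ∷ s ∷ [])))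
          (gauss-factorial-at (suc a) (suc s) (n ℕ.+ n) (n ℕ.+ suc i) c
             (solve (i ∷ s ∷ [])) (solve (i ∷ s ∷ [])) (solve (i ∷ s ∷ [])))
          (gauss-factorial-at a (suc (suc s)) (n ℕ.+ n) (n ℕ.+ i) c
             (solve (i ∷ s ∷ [])) (solve (i ∷ s ∷ [])) (solve (i ∷ s ∷ [])))
          (gauss-factorial-at (suc (suc a)) s (n ℕ.+ n) (n ℕ.+ suc (suc i)) c
             (solve (i ∷ s ∷ [])) (solve (i ∷ s ∷ [])) (solve (i ∷ s ∷ [])))
          (*-≢0 (qfact≢0 (suc (suc a))) (qfact≢0 (suc (suc s))))
          (recurrence-numerators-2n (q ^ i) (q ^ s) 1/[1-q] (qfact c)
            (monomial n i s 1 1 2 (solve (i ∷ s ∷ []))) (monomial (suc i ℕ.+ suc i) i s 2 0 2 (solve (i ∷ s ∷ [])))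
            (monomial (suc n ℕ.+ suc n) i s 2 2 6 (solve (i ∷ s ∷ []))) (monomial i i s 1 0 0 (solve (i ∷ s ∷ [])))
            (monomial (suc (suc i)) i s 1 0 2 (solve (i ∷ s ∷ []))) (monomial (suc (suc s)) i s 0 1 2 (solve (i ∷ s ∷ [])))
            (monomial (suc (suc (i ℕ.+ i ℕ.+ i ℕ.+ suc (suc s)))) i s 3 1 4 (solve (i ∷ s ∷ [])))
            (monomial a i s 2 1 2 (solve (i ∷ s ∷ []))) (monomial (suc a) i s 2 1 3 (solve (i ∷ s ∷ [])))
            (monomial s i s 0 1 0 (solve (i ∷ s ∷ []))) (monomial (suc s) i s 0 1 1 (solve (i ∷ s ∷ [])))
            (monomial c i s 2 2 4 (solve (i ∷ s ∷ []))) (monomial (suc c) i s 2 2 5 (solve (i ∷ s ∷ [])))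
            (qint≡ n) (qint≡ (suc i ℕ.+ suc i)) (qint≡ (suc n ℕ.+ suc n)) (qint≡ i) (qint≡ (suc (suc i))))
    in begin
      [n] * ([2i+2] * g₁)                                          ≡⟨ ℚP.*-assoc [n] [2i+2] g₁ ⟨
      ([n] * [2i+2]) * g₁                                          ≡⟨ relation ⟩
      ([2n+2] * [2i+2]) * g₂ + ([2n+2] * (q^r * [i])) * g₃ + ([2n+2] * (q^[3i+r+2] * [i+2])) * g₄
                                                               ≡⟨ factor [2n+2] [2i+2] g₂ q^r [i] g₃ q^[3i+r+2] [i+2] g₄ ⟩
      [2n+2] * ([2i+2] * g₂ + q^r * ([i] * g₃) + q^[3i+r+2] * ([i+2] * g₄))     ∎
    where
    factor : ∀ c b g₂ q^r [i] g₃ q^[3i+r+2] [i+2] g₄ → (c * b) * g₂ + (c * (q^r * [i])) * g₃ + (c * (q^[3i+r+2] * [i+2])) * g₄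
             ≡ c * (b * g₂ + q^r * ([i] * g₃) + q^[3i+r+2] * ([i+2] * g₄))
    factor = solve-∀ ℚ-ring

  private
    recurrence-numerators-2n+1 : ∀ X Y M {Pt1 Pt2 Pn1 P₁ P₂ P₃ P₄ P₅ P₆} →
      Pt1 ≡ X ^ 1 * Y ^ 0 * q ^ 1 → Pt2 ≡ X ^ 1 * Y ^ 0 * q ^ 2 → Pn1 ≡ X ^ 1 * Y ^ 1 * q ^ 3 →
      P₁ ≡ X ^ 2 * Y ^ 1 * q ^ 3 → P₂ ≡ X ^ 2 * Y ^ 1 * q ^ 4 → P₃ ≡ X ^ 0 * Y ^ 1 * q ^ 0 →
      P₄ ≡ X ^ 0 * Y ^ 1 * q ^ 1 → P₅ ≡ X ^ 2 * Y ^ 2 * q ^ 5 → P₆ ≡ X ^ 2 * Y ^ 2 * q ^ 6 →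
      Pt1 * (M * (1ℚ - q * P₅) * (1ℚ - q * P₆))
      ≡ ((1ℚ + Pn1 * Pn1) * Pt1) * ((1ℚ - q * P₂) * (1ℚ - q * P₄) * M) + Pn1 * ((1ℚ - q * P₁) * (1ℚ - q * P₂) * M)
        + (Pn1 * (Pt1 * Pt2)) * ((1ℚ - q * P₃) * (1ℚ - q * P₄) * M)
    recurrence-numerators-2n+1 X Y M refl refl refl refl refl refl refl refl refl = identity q X Y M
      where
      identity : ∀ q X Y M →
        let X¹ = X * 1ℚ; X² = X * X¹; Y¹ = Y * 1ℚ; Y² = Y * Y¹
            q¹ = q * 1ℚ; q² = q * q¹; q³ = q * q²; q⁴ = q * q³; q⁵ = q * q⁴; q⁶ = q * q⁵
            Pt1 = X¹ * 1ℚ * q¹; Pt2 = X¹ * 1ℚ * q²; Pn1 = X¹ * Y¹ * q³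
            P₁ = X² * Y¹ * q³; P₂ = X² * Y¹ * q⁴; P₃ = 1ℚ * Y¹ * 1ℚ
            P₄ = 1ℚ * Y¹ * q¹; P₅ = X² * Y² * q⁵; P₆ = X² * Y² * q⁶
        in Pt1 * (M * (1ℚ - q * P₅) * (1ℚ - q * P₆))
          ≡ ((1ℚ + Pn1 * Pn1) * Pt1) * ((1ℚ - q * P₂) * (1ℚ - q * P₄) * M) + Pn1 * ((1ℚ - q * P₁) * (1ℚ - q * P₂) * M)
            + (Pn1 * (Pt1 * Pt2)) * ((1ℚ - q * P₃) * (1ℚ - q * P₄) * M)
      identity = solve-∀ ℚ-ring

    recurrence-2n+1-boundary : ∀ X Y I {Pt1 Pt2 Pm} →
      Pt1 ≡ X ^ 1 * Y ^ 0 * q ^ 1 → Pt2 ≡ X ^ 1 * Y ^ 0 * q ^ 2 → Pm ≡ X ^ 2 * Y ^ 0 * q ^ 3 →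
      Pt1 * (1ℚ + q * (Pm + I)) ≡ (1ℚ + Pt2 * Pt2) * (Pt1 * 1ℚ) + Pt2 * (I + Pt1 * Pt2 * 0ℚ)
    recurrence-2n+1-boundary X Y I refl refl refl = identity q X I
      where
      identity : ∀ q X I →
        let X¹ = X * 1ℚ; X² = X * X¹; q¹ = q * 1ℚ; q² = q * q¹; q³ = q * q²
            Pt1 = X¹ * 1ℚ * q¹; Pt2 = X¹ * 1ℚ * q²; Pm = X² * 1ℚ * q³
        in Pt1 * (1ℚ + q * (Pm + I)) ≡ (1ℚ + Pt2 * Pt2) * (Pt1 * 1ℚ) + Pt2 * (I + Pt1 * Pt2 * 0ℚ)
      identity = solve-∀ ℚ-ring

  gauss-2n+1-recurrence : ∀ t r → let n = t ℕ.+ r in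
    q ^ suc t * gauss-2n+1 (suc n) (suc (suc t))
    ≡ (1ℚ + q ^ suc n * q ^ suc n) * (q ^ suc t * gauss-2n+1 n (suc (suc t)))
      + q ^ suc n * (gauss-2n+1 n (suc t) + q ^ suc t * q ^ suc (suc t) * gauss-2n+1 n (suc (suc (suc t))))
  gauss-2n+1-recurrence t zero rewrite ℕP.+-identityʳ t = begin
    x * gauss-2n+1 (suc t) (suc (suc t))
      ≡⟨ cong (x *_) (gauss-2n+1-diag (suc t)) ⟩
    x * 1ℚ
      ≡⟨ boundary x (q ^ suc (suc t)) ⟩
    (1ℚ + x * x) * (x * 0ℚ) + x * (1ℚ + x * q ^ suc (suc t) * 0ℚ)
      ≡⟨ cong₃ (λ a b c → (1ℚ + x * x) * (x * a) + x * (b + x * q ^ suc (suc t) * c))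
               (sym (gauss-2n+1-above t (ℕP.n<1+n (suc t)))) (sym (gauss-2n+1-diag t))
               (sym (gauss-2n+1-above t (ℕP.m<n⇒m<1+n (ℕP.n<1+n (suc t))))) ⟩
    (1ℚ + x * x) * (x * gauss-2n+1 t (suc (suc t)))
      + x * (gauss-2n+1 t (suc t) + x * q ^ suc (suc t) * gauss-2n+1 t (suc (suc (suc t))))
      ∎
    where
    x = q ^ suc t
    boundary : ∀ x y → x * 1ℚ ≡ (1ℚ + x * x) * (x * 0ℚ) + x * (1ℚ + x * y * 0ℚ)
    boundary = solve-∀ ℚ-ring
  gauss-2n+1-recurrence t (suc zero) rewrite ℕP.+-comm t 1 = begin
    q^[t+1] * gauss-2n+1 (suc (suc t)) (suc (suc t))
      ≡⟨ cong (q^[t+1] *_) (trans (gauss-2n+1-pred (suc (suc t))) (qint-suc (suc (suc t) ℕ.+ suc (suc t)))) ⟩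
    q^[t+1] * (1ℚ + q * (q ^ (suc t ℕ.+ suc (suc t)) + qint q (suc t ℕ.+ suc (suc t))))
      ≡⟨ cong (λ m → q^[t+1] * (1ℚ + q * (q ^ m + qint q m))) (ℕP.+-suc (suc t) (suc t)) ⟩
    q^[t+1] * (1ℚ + q * (q ^ suc (suc t ℕ.+ suc t) + [2t+3]))
      ≡⟨ recurrence-2n+1-boundary (q ^ t) (q ^ t) [2t+3] (monomial (suc t) t t 1 0 1 (solve (t ∷ [])))
           (monomial (suc (suc t)) t t 1 0 2 (solve (t ∷ []))) (monomial (suc (suc t ℕ.+ suc t)) t t 2 0 3 (solve (t ∷ []))) ⟩
    (1ℚ + q^[t+2] * q^[t+2]) * (q^[t+1] * 1ℚ) + q^[t+2] * ([2t+3] + q^[t+1] * q^[t+2] * 0ℚ)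
      ≡⟨ cong₃ (λ a b c → (1ℚ + q^[t+2] * q^[t+2]) * (q^[t+1] * a) + q^[t+2] * (b + q^[t+1] * q^[t+2] * c))
               (sym (gauss-2n+1-diag (suc t))) (sym (gauss-2n+1-pred (suc t))) (sym (gauss-2n+1-above (suc t) (ℕP.n<1+n (suc (suc t))))) ⟩
    (1ℚ + q^[t+2] * q^[t+2]) * (q^[t+1] * gauss-2n+1 (suc t) (suc (suc t)))
      + q^[t+2] * (gauss-2n+1 (suc t) (suc t) + q^[t+1] * q^[t+2] * gauss-2n+1 (suc t) (suc (suc (suc t))))
      ∎
    where
    q^[t+1] = q ^ suc t
    q^[t+2] = q ^ suc (suc t)
    [2t+3] = qint q (suc (suc t ℕ.+ suc t))
  gauss-2n+1-recurrence t (suc (suc s)) =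
    let n = t ℕ.+ suc (suc s)
        a = 2 ℕ.* t ℕ.+ s ℕ.+ 3
        c = 2 ℕ.* t ℕ.+ 2 ℕ.* s ℕ.+ 5
        q^[t+1] = q ^ suc t
        q^[t+2] = q ^ suc (suc t)
        q^[n+1] = q ^ suc n
        g₁ = gauss-2n+1 (suc n) (suc (suc t))
        g₂ = gauss-2n+1 n (suc (suc t))
        g₃ = gauss-2n+1 n (suc t)
        g₄ = gauss-2n+1 n (suc (suc (suc t)))
        u : ℕ → ℚ
        u m = 1ℚ - q * q ^ m
        relation : q^[t+1] * g₁ ≡ ((1ℚ + q^[n+1] * q^[n+1]) * q^[t+1]) * g₂ + q^[n+1] * g₃ + (q^[n+1] * (q^[t+1] * q^[t+2])) * g₄
        relation = combine-fractions₃ (qfact a) (qfact s) (u a) (u (suc a)) (u s) (u (suc s)) (qfact c) (qfact (suc (suc c)))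
          g₁ g₂ g₃ g₄ q^[t+1] ((1ℚ + q^[n+1] * q^[n+1]) * q^[t+1]) q^[n+1] (q^[n+1] * (q^[t+1] * q^[t+2]))
          (gauss-factorial-at (suc (suc a)) (suc (suc s)) (suc (suc n ℕ.+ suc n)) (suc n ℕ.+ suc (suc t)) (suc (suc c))
             (solve (t ∷ s ∷ [])) (solve (t ∷ s ∷ [])) (solve (t ∷ s ∷ [])))
          (gauss-factorial-at (suc a) (suc s) (suc (n ℕ.+ n)) (n ℕ.+ suc (suc t)) c
             (solve (t ∷ s ∷ [])) (solve (t ∷ s ∷ [])) (solve (t ∷ s ∷ [])))
          (gauss-factorial-at a (suc (suc s)) (suc (n ℕ.+ n)) (n ℕ.+ suc t) c
             (solve (t ∷ s ∷ [])) (solve (t ∷ s ∷ [])) (solve (t ∷ s ∷ [])))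
          (gauss-factorial-at (suc (suc a)) s (suc (n ℕ.+ n)) (n ℕ.+ suc (suc (suc t))) c
             (solve (t ∷ s ∷ [])) (solve (t ∷ s ∷ [])) (solve (t ∷ s ∷ [])))
          (*-≢0 (qfact≢0 (suc (suc a))) (qfact≢0 (suc (suc s))))
          (recurrence-numerators-2n+1 (q ^ t) (q ^ s) (qfact c)
            (monomial (suc t) t s 1 0 1 (solve (t ∷ s ∷ []))) (monomial (suc (suc t)) t s 1 0 2 (solve (t ∷ s ∷ [])))
            (monomial (suc n) t s 1 1 3 (solve (t ∷ s ∷ []))) (monomial a t s 2 1 3 (solve (t ∷ s ∷ [])))
            (monomial (suc a) t s 2 1 4 (solve (t ∷ s ∷ []))) (monomial s t s 0 1 0 (solve (t ∷ s ∷ [])))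
            (monomial (suc s) t s 0 1 1 (solve (t ∷ s ∷ []))) (monomial c t s 2 2 5 (solve (t ∷ s ∷ [])))
            (monomial (suc c) t s 2 2 6 (solve (t ∷ s ∷ []))))
    in trans relation (factor q^[t+1] q^[t+2] q^[n+1] g₂ g₃ g₄)
    where
    factor : ∀ a b c g₂ g₃ g₄ → ((1ℚ + c * c) * a) * g₂ + c * g₃ + (c * (a * b)) * g₄
             ≡ (1ℚ + c * c) * (a * g₂) + c * (g₃ + a * b * g₄)
    factor = solve-∀ ℚ-ring

  private
    difference-numerators : ∀ X Y v M {Pn1 Pd P₁ P₃ P₅ In1 Id} →
      Pn1 ≡ X ^ 1 * Y ^ 1 * q ^ 1 → Pd ≡ X ^ 1 * Y ^ 0 * q ^ 0 → P₁ ≡ X ^ 2 * Y ^ 1 * q ^ 0 →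
      P₃ ≡ X ^ 0 * Y ^ 1 * q ^ 0 → P₅ ≡ X ^ 2 * Y ^ 2 * q ^ 1 →
      In1 ≡ (1ℚ - Pn1) * v → Id ≡ (1ℚ - Pd) * v →
      In1 * ((1ℚ - q * P₁) * M) ≡ (In1 * Pd) * ((1ℚ - q * P₃) * M) + Id * (M * (1ℚ - q * P₅))
    difference-numerators X Y v M refl refl refl refl refl refl refl = identity q X Y v M
      where
      identity : ∀ q X Y v M →
        let X¹ = X * 1ℚ; X² = X * X¹; Y¹ = Y * 1ℚ; Y² = Y * Y¹; q¹ = q * 1ℚ
            Pn1 = X¹ * Y¹ * q¹; Pd = X¹ * 1ℚ * 1ℚ; P₁ = X² * Y¹ * 1ℚ; P₃ = 1ℚ * Y¹ * 1ℚ; P₅ = X² * Y² * q¹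
            In1 = (1ℚ - Pn1) * v; Id = (1ℚ - Pd) * v
        in In1 * ((1ℚ - q * P₁) * M) ≡ (In1 * Pd) * ((1ℚ - q * P₃) * M) + Id * (M * (1ℚ - q * P₅))
      identity = solve-∀ ℚ-ring

  gauss-2n+1-difference : ∀ d n →
    qint q (suc n) * (gauss-2n+1 n d - q ^ d * gauss-2n+1 n (suc d)) ≡ qint q d * gauss-2n (suc n) d
  gauss-2n+1-difference d n with ℕP.<-cmp (suc n) d
  ... | tri< n+1<d _ _ = begin
    qint q (suc n) * (gauss-2n+1 n d - q ^ d * gauss-2n+1 n (suc d))
      ≡⟨ cong₂ (λ x y → qint q (suc n) * (x - q ^ d * y)) (gauss-2n+1-above n n+1<d) (gauss-2n+1-above n (ℕP.m<n⇒m<1+n n+1<d)) ⟩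
    qint q (suc n) * (0ℚ - q ^ d * 0ℚ)
      ≡⟨ vanish (qint q (suc n)) (q ^ d) (qint q d) ⟩
    qint q d * 0ℚ
      ≡⟨ cong (qint q d *_) (sym (gauss-2n-above (suc n) n+1<d)) ⟩
    qint q d * gauss-2n (suc n) d
      ∎
    where vanish : ∀ a b c → a * (0ℚ - b * 0ℚ) ≡ c * 0ℚ
          vanish = solve-∀ ℚ-ring
  ... | tri≈ _ refl _ = begin
    qint q (suc n) * (gauss-2n+1 n (suc n) - q ^ suc n * gauss-2n+1 n (suc (suc n)))
      ≡⟨ cong₂ (λ x y → qint q (suc n) * (x - q ^ suc n * y)) (gauss-2n+1-diag n) (gauss-2n+1-above n (ℕP.n<1+n (suc n))) ⟩
    qint q (suc n) * (1ℚ - q ^ suc n * 0ℚ)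
      ≡⟨ cong (qint q (suc n) *_) (vanish (q ^ suc n)) ⟩
    qint q (suc n) * 1ℚ
      ≡⟨ cong (qint q (suc n) *_) (sym (gauss-2n-diag (suc n))) ⟩
    qint q (suc n) * gauss-2n (suc n) (suc n)
      ∎
    where vanish : ∀ b → 1ℚ - b * 0ℚ ≡ 1ℚ
          vanish = solve-∀ ℚ-ring
  ... | tri> _ _ d<n+1 = subst (λ n → qint q (suc n) * (gauss-2n+1 n d - q ^ d * gauss-2n+1 n (suc d)) ≡ qint q d * gauss-2n (suc n) d)
                                (ℕP.m+[n∸m]≡n (ℕP.≤-pred d<n+1)) (interior (n ∸ d))
    where
    interior : ∀ s → let m = d ℕ.+ s in
      qint q (suc m) * (gauss-2n+1 m d - q ^ d * gauss-2n+1 m (suc d)) ≡ qint q d * gauss-2n (suc m) d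
    interior s =
      let m = d ℕ.+ s
          a = 2 ℕ.* d ℕ.+ s
          c = 2 ℕ.* d ℕ.+ 2 ℕ.* s ℕ.+ 1
          [m+1] = qint q (suc m)
          [d] = qint q d
          q^d = q ^ d
          g₁ = gauss-2n+1 m d
          g₂ = gauss-2n+1 m (suc d)
          g₃ = gauss-2n (suc m) d
          u : ℕ → ℚ
          u k = 1ℚ - q * q ^ k
          relation : [m+1] * g₁ ≡ ([m+1] * q^d) * g₂ + [d] * g₃
          relation = combine-fractions₂ (qfact a) (qfact s) (u a) (u s) (qfact c) (qfact (suc c)) g₁ g₂ g₃ [m+1] ([m+1] * q^d) [d]
            (gauss-factorial-at a (suc s) (suc (m ℕ.+ m)) (m ℕ.+ d) c
               (solve (d ∷ s ∷ [])) (solve (d ∷ s ∷ [])) (solve (d ∷ s ∷ [])))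
            (gauss-factorial-at (suc a) s (suc (m ℕ.+ m)) (m ℕ.+ suc d) c
               (solve (d ∷ s ∷ [])) (solve (d ∷ s ∷ [])) (solve (d ∷ s ∷ [])))
            (gauss-factorial-at (suc a) (suc s) (suc m ℕ.+ suc m) (suc m ℕ.+ d) (suc c)
               (solve (d ∷ s ∷ [])) (solve (d ∷ s ∷ [])) (solve (d ∷ s ∷ [])))
            (*-≢0 (qfact≢0 (suc a)) (qfact≢0 (suc s)))
            (difference-numerators (q ^ d) (q ^ s) 1/[1-q] (qfact c)
              (monomial (suc m) d s 1 1 1 (solve (d ∷ s ∷ []))) (monomial d d s 1 0 0 (solve (d ∷ s ∷ [])))
              (monomial a d s 2 1 0 (solve (d ∷ s ∷ []))) (monomial s d s 0 1 0 (solve (d ∷ s ∷ [])))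
              (monomial c d s 2 2 1 (solve (d ∷ s ∷ [])))
              (qint≡ (suc m)) (qint≡ d))
      in begin
        [m+1] * (g₁ - q^d * g₂)                          ≡⟨ distribute [m+1] g₁ q^d g₂ ⟩
        [m+1] * g₁ - ([m+1] * q^d) * g₂                    ≡⟨ cong (_- ([m+1] * q^d) * g₂) relation ⟩
        ([m+1] * q^d) * g₂ + [d] * g₃ - ([m+1] * q^d) * g₂   ≡⟨ cancel (([m+1] * q^d) * g₂) ([d] * g₃) ⟩
        [d] * g₃                                       ∎
      where
      distribute : ∀ a g₁ p g₂ → a * (g₁ - p * g₂) ≡ a * g₁ - (a * p) * g₂
      distribute = solve-∀ ℚ-ring
      cancel : ∀ x y → x + y - x ≡ y
      cancel = solve-∀ ℚ-ring

-- `w` is the identity for the first identity and squaring for the second.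
module Summands (q : ℚ) (q≢1 : q ≢ 1ℚ) (q≢-1 : q ≢ - 1ℚ) (d : ℕ) (w : ℚ → ℚ) where

  open Recurrences q q≢1 q≢-1

  summand : ℕ → ℕ → ℚ
  summand n k = q ^ k * qbinom q (2 ℕ.* k) (k ℕ.+ d) * w (qpoch (- (q ^ suc k)) q (n ∸ k)) ⊘ qint q k

  qpoch-extend : ∀ k n → k ≤ n → qpoch (- (q ^ suc k)) q (suc n ∸ k) ≡ qpoch (- (q ^ suc k)) q (n ∸ k) * (1ℚ + q ^ suc n)
  qpoch-extend k n k≤n = begin
    qpoch x q (suc n ∸ k)                                ≡⟨ cong (qpoch x q) (ℕP.+-∸-assoc 1 k≤n) ⟩
    qpoch x q (n ∸ k) * (1ℚ - (- q ^ suc k) * q ^ (n ∸ k)) ≡⟨ cong (qpoch x q (n ∸ k) *_) (negate (q ^ suc k) (q ^ (n ∸ k))) ⟩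
    qpoch x q (n ∸ k) * (1ℚ + q ^ suc k * q ^ (n ∸ k))   ≡⟨ cong (λ y → qpoch x q (n ∸ k) * (1ℚ + y)) (sym (^-+ q (suc k) (n ∸ k))) ⟩
    qpoch x q (n ∸ k) * (1ℚ + q ^ (suc k ℕ.+ (n ∸ k)))   ≡⟨ cong (λ m → qpoch x q (n ∸ k) * (1ℚ + q ^ suc m)) (ℕP.m+[n∸m]≡n k≤n) ⟩
    qpoch x q (n ∸ k) * (1ℚ + q ^ suc n)                 ∎
    where
    x = - (q ^ suc k)
    negate : ∀ a b → 1ℚ - (- a) * b ≡ 1ℚ + a * b
    negate = solve-∀ ℚ-ring

  summand-suc : ∀ n c → (∀ x → w (x * (1ℚ + q ^ suc n)) ≡ w x * c) →
                ∀ k → k ≤ n → summand (suc n) k ≡ summand n k * c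
  summand-suc n c w-step k k≤n = begin
    q ^ k * B * w (qpoch x q (suc n ∸ k)) ⊘ qint q k                 ≡⟨ cong (λ y → q ^ k * B * w y ⊘ qint q k) (qpoch-extend k n k≤n) ⟩
    q ^ k * B * w (qpoch x q (n ∸ k) * (1ℚ + q ^ suc n)) ⊘ qint q k  ≡⟨ cong (λ y → q ^ k * B * y ⊘ qint q k) (w-step _) ⟩
    q ^ k * B * (w (qpoch x q (n ∸ k)) * c) ⊘ qint q k               ≡⟨ cong (_⊘ qint q k) (sym (ℚP.*-assoc (q ^ k * B) _ c)) ⟩
    q ^ k * B * w (qpoch x q (n ∸ k)) * c ⊘ qint q k                 ≡⟨ sym (⊘-*-comm _ (qint q k) c) ⟩
    (q ^ k * B * w (qpoch x q (n ∸ k)) ⊘ qint q k) * c               ∎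
    where
    x = - (q ^ suc k)
    B = qbinom q (2 ℕ.* k) (k ℕ.+ d)

  sum-summand-suc : ∀ n c → (∀ x → w (x * (1ℚ + q ^ suc n)) ≡ w x * c) →
                    sumFrom 1 n (summand (suc n)) ≡ sumFrom 1 n (summand n) * c
  sum-summand-suc n c w-step = trans (sumFrom-cong 1 n λ k _ k<1+n → summand-suc n c w-step k (ℕP.≤-pred k<1+n))
                                     (sumFrom-*ʳ 1 n (summand n) c)

  summand-diag : ∀ n → qint q (suc n) * summand (suc n) (suc n) ≡ q ^ suc n * gauss-2n (suc n) d * w 1ℚ
  summand-diag n = begin
    qint q (suc n) * summand (suc n) (suc n)
      ≡⟨ ℚP.*-comm (qint q (suc n)) _ ⟩
    summand (suc n) (suc n) * qint q (suc n)
      ≡⟨ ⊘-*-cancelʳ _ (qint≢0 n) ⟩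
    q ^ suc n * qbinom q (2 ℕ.* suc n) (suc n ℕ.+ d) * w (qpoch (- (q ^ suc (suc n))) q (n ∸ n))
      ≡⟨ cong₂ (λ g m → q ^ suc n * g * w (qpoch (- (q ^ suc (suc n))) q m)) binomial (ℕP.n∸n≡0 n) ⟩
    q ^ suc n * gauss-2n (suc n) d * w 1ℚ
      ∎
    where binomial : qbinom q (2 ℕ.* suc n) (suc n ℕ.+ d) ≡ gauss-2n (suc n) d
          binomial = trans (qbinom≡gauss (2 ℕ.* suc n) (suc n ℕ.+ d)) (cong (λ N → gauss N (suc n ℕ.+ d)) (cong (suc n ℕ.+_) (ℕP.+-identityʳ (suc n))))

  summand-below : ∀ n k → k < d → summand n k ≡ 0ℚ
  summand-below n k k<d = begin
    q ^ k * qbinom q (2 ℕ.* k) (k ℕ.+ d) * P ⊘ qint q k  ≡⟨ cong (λ b → q ^ k * b * P ⊘ qint q k) (qbinom-above _ _ 2k<k+d) ⟩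
    q ^ k * 0ℚ * P ⊘ qint q k                            ≡⟨ cong (_⊘ qint q k) (vanish (q ^ k) P) ⟩
    0ℚ ⊘ qint q k                                        ≡⟨ 0⊘x≡0 (qint q k) ⟩
    0ℚ                                                   ∎
    where
    P = w (qpoch (- (q ^ suc k)) q (n ∸ k))
    2k<k+d : 2 ℕ.* k < k ℕ.+ d
    2k<k+d = subst (_< k ℕ.+ d) (cong (k ℕ.+_) (sym (ℕP.+-identityʳ k))) (ℕP.+-monoʳ-< k k<d)
    vanish : ∀ a b → a * 0ℚ * b ≡ 0ℚ
    vanish = solve-∀ ℚ-ring

module FirstIdentity (q : ℚ) (q≢1 : q ≢ 1ℚ) (q≢-1 : q ≢ - 1ℚ) (dd : ℕ) where

  open Recurrences q q≢1 q≢-1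

  d : ℕ
  d = suc dd

  open Summands q q≢1 q≢-1 d (λ P → P)

  ι : ℕ → ℕ
  ι t = d ℕ.+ 2 ℕ.* t

  ι-suc : ∀ t → ι (suc t) ≡ suc (suc (ι t))
  ι-suc t = unfolded t
    where unfolded : ∀ t → suc dd ℕ.+ 2 ℕ.* suc t ≡ suc (suc (suc dd ℕ.+ 2 ℕ.* t))
          unfolded t = solve (t ∷ dd ∷ [])

  sign : ℕ → ℚ
  sign t = (- 1ℚ) ^ t

  term-weight : ℕ → ℚ
  term-weight t = sign t * q ^ (3 ℕ.* t ℕ.* t ℕ.+ 3 ℕ.* dd ℕ.* t ℕ.+ 4 ℕ.* t ℕ.+ d) * qint q (suc (ι t) ℕ.+ suc (ι t))

  term : ℕ → ℕ → ℚ
  term N t = term-weight t * gauss-2n N (suc (ι t))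

  certificate-weight : ℕ → ℕ → ℚ
  certificate-weight n t = sign t * q ^ (3 ℕ.* t ℕ.* t ℕ.+ 3 ℕ.* dd ℕ.* t ℕ.+ 2 ℕ.* t ℕ.+ n) * qint q (ι t)

  -- The telescoping partner of `term` in the recurrence in `n`.
  certificate : ℕ → ℕ → ℚ
  certificate n t = certificate-weight n t * gauss-2n n (ι t)

  term-recurrence-from : ∀ t r → let n = ι t ℕ.+ r in
    qint q n * term (suc n) t ≡ qint q (suc n ℕ.+ suc n) * (term n t + (certificate n t - certificate n (suc t)))
  term-recurrence-from t r = begin
    [n] * (σ * q^E * [2ι+2] * g₁)
      ≡⟨ pull-out [n] σ q^E [2ι+2] g₁ ⟩
    σ * q^E * ([n] * ([2ι+2] * g₁))
      ≡⟨ cong (σ * q^E *_) (gauss-2n-recurrence (ι t) r) ⟩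
    σ * q^E * ([2n+2] * ([2ι+2] * g₂ + q ^ r * ([ι] * g₃) + q^b * ([ι+2] * g₄)))
      ≡⟨ distribute σ q^E [2n+2] [2ι+2] g₂ (q ^ r) [ι] g₃ q^b [ι+2] g₄ ⟩
    [2n+2] * (σ * q^E * [2ι+2] * g₂ + (σ * (q^E * q ^ r) * [ι] * g₃ - (- 1ℚ * σ) * (q^E * q^b) * [ι+2] * g₄))
      ≡⟨ cong₂ (λ x y → [2n+2] * (σ * q^E * [2ι+2] * g₂ + (σ * x * [ι] * g₃ - (- 1ℚ * σ) * y * [ι+2] * g₄))) shift₁ shift₂ ⟩
    [2n+2] * (σ * q^E * [2ι+2] * g₂ + (σ * q ^ F t * [ι] * g₃ - (- 1ℚ * σ) * q ^ F (suc t) * [ι+2] * g₄))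
      ≡⟨ cong₂ (λ m k → [2n+2] * (σ * q^E * [2ι+2] * g₂ + (σ * q ^ F t * [ι] * g₃ - (- 1ℚ * σ) * q ^ F (suc t) * qint q m * gauss-2n n k)))
               (sym (ι-suc t)) (sym (ι-suc t)) ⟩
    [2n+2] * (term n t + (certificate n t - certificate n (suc t)))
      ∎
    where
    n = ι t ℕ.+ r
    σ = sign t
    E = 3 ℕ.* t ℕ.* t ℕ.+ 3 ℕ.* dd ℕ.* t ℕ.+ 4 ℕ.* t ℕ.+ d
    q^E = q ^ E
    [n] = qint q n
    [2ι+2] = qint q (suc (ι t) ℕ.+ suc (ι t))
    [2n+2] = qint q (suc n ℕ.+ suc n)
    [ι] = qint q (ι t)
    [ι+2] = qint q (suc (suc (ι t)))
    b = suc (suc (ι t ℕ.+ ι t ℕ.+ ι t ℕ.+ r))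
    q^b = q ^ b
    g₁ = gauss-2n (suc n) (suc (ι t))
    g₂ = gauss-2n n (suc (ι t))
    g₃ = gauss-2n n (ι t)
    g₄ = gauss-2n n (suc (suc (ι t)))
    F : ℕ → ℕ
    F t = 3 ℕ.* t ℕ.* t ℕ.+ 3 ℕ.* dd ℕ.* t ℕ.+ 2 ℕ.* t ℕ.+ n
    exponent₁ : 3 ℕ.* t ℕ.* t ℕ.+ 3 ℕ.* dd ℕ.* t ℕ.+ 4 ℕ.* t ℕ.+ suc dd ℕ.+ r
                ≡ 3 ℕ.* t ℕ.* t ℕ.+ 3 ℕ.* dd ℕ.* t ℕ.+ 2 ℕ.* t ℕ.+ (suc dd ℕ.+ 2 ℕ.* t ℕ.+ r)
    exponent₁ = solve (t ∷ dd ∷ r ∷ [])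
    exponent₂ : 3 ℕ.* t ℕ.* t ℕ.+ 3 ℕ.* dd ℕ.* t ℕ.+ 4 ℕ.* t ℕ.+ suc dd
                  ℕ.+ suc (suc ((suc dd ℕ.+ 2 ℕ.* t) ℕ.+ (suc dd ℕ.+ 2 ℕ.* t) ℕ.+ (suc dd ℕ.+ 2 ℕ.* t) ℕ.+ r))
                ≡ 3 ℕ.* suc t ℕ.* suc t ℕ.+ 3 ℕ.* dd ℕ.* suc t ℕ.+ 2 ℕ.* suc t ℕ.+ (suc dd ℕ.+ 2 ℕ.* t ℕ.+ r)
    exponent₂ = solve (t ∷ dd ∷ r ∷ [])
    shift₁ : q^E * q ^ r ≡ q ^ F t
    shift₁ = trans (sym (^-+ q E r)) (cong (q ^_) exponent₁)
    shift₂ : q^E * q^b ≡ q ^ F (suc t)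
    shift₂ = trans (sym (^-+ q E b)) (cong (q ^_) exponent₂)
    pull-out : ∀ [n] σ q^E I g → [n] * (σ * q^E * I * g) ≡ σ * q^E * ([n] * (I * g))
    pull-out = solve-∀ ℚ-ring
    distribute : ∀ σ q^E [2n+2] [2ι+2] g₂ Pr [ι] g₃ q^b [ι+2] g₄ →
      σ * q^E * ([2n+2] * ([2ι+2] * g₂ + Pr * ([ι] * g₃) + q^b * ([ι+2] * g₄)))
      ≡ [2n+2] * (σ * q^E * [2ι+2] * g₂ + (σ * (q^E * Pr) * [ι] * g₃ - (- 1ℚ * σ) * (q^E * q^b) * [ι+2] * g₄))
    distribute = solve-∀ ℚ-ring

  term-recurrence : ∀ n t →
    qint q n * term (suc n) t ≡ qint q (suc n ℕ.+ suc n) * (term n t + (certificate n t - certificate n (suc t)))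
  term-recurrence n t with ℕP.<-cmp n (ι t)
  ... | tri< n<ι _ _ = begin
    qint q n * (T * gauss-2n (suc n) (suc (ι t)))
      ≡⟨ cong (λ g → qint q n * (T * g)) (gauss-2n-above (suc n) (s≤s n<ι)) ⟩
    qint q n * (T * 0ℚ)
      ≡⟨ vanish (qint q n) (qint q (suc n ℕ.+ suc n)) T Cₜ Cₜ₊₁ ⟩
    qint q (suc n ℕ.+ suc n) * (T * 0ℚ + (Cₜ * 0ℚ - Cₜ₊₁ * 0ℚ))
      ≡⟨ cong₃ (λ x y z → qint q (suc n ℕ.+ suc n) * (T * x + (Cₜ * y - Cₜ₊₁ * z)))
               (sym (gauss-2n-above n (ℕP.m<n⇒m<1+n n<ι))) (sym (gauss-2n-above n n<ι))
               (sym (gauss-2n-above n (subst (n <_) (sym (ι-suc t)) (ℕP.m<n⇒m<1+n (ℕP.m<n⇒m<1+n n<ι))))) ⟩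
    qint q (suc n ℕ.+ suc n) * (term n t + (certificate n t - certificate n (suc t)))
      ∎
    where
    T = term-weight t
    Cₜ = certificate-weight n t
    Cₜ₊₁ = certificate-weight n (suc t)
    vanish : ∀ a b c e f → a * (c * 0ℚ) ≡ b * (c * 0ℚ + (e * 0ℚ - f * 0ℚ))
    vanish = solve-∀ ℚ-ring
  ... | tri≈ _ refl _ = subst (λ m → qint q m * term (suc m) t ≡ qint q (suc m ℕ.+ suc m) * (term m t + (certificate m t - certificate m (suc t))))
                              (ℕP.+-identityʳ (ι t)) (term-recurrence-from t 0)
  ... | tri> _ _ ι<n = subst (λ m → qint q m * term (suc m) t ≡ qint q (suc m ℕ.+ suc m) * (term m t + (certificate m t - certificate m (suc t))))
                              (ℕP.m+[n∸m]≡n (ℕP.<⇒≤ ι<n)) (term-recurrence-from t (n ∸ ι t))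

  rhs : ℕ → ℚ
  rhs N = sumFrom 0 N (term N)

  term-vanishes : ∀ N t → N ≤ ι t → term N t ≡ 0ℚ
  term-vanishes N t N≤ι = *-zeroʳ-≡ (term-weight t) (gauss-2n-above N (s≤s N≤ι))

  rhs-recurrence : ∀ n → qint q n * rhs (suc n) ≡ qint q (suc n ℕ.+ suc n) * (rhs n + certificate n 0)
  rhs-recurrence n = begin
    qint q n * sumFrom 0 (suc n) (term (suc n))
      ≡⟨ sym (sumFrom-*ˡ 0 (suc n) (term (suc n)) (qint q n)) ⟩
    sumFrom 0 (suc n) (λ t → qint q n * term (suc n) t)
      ≡⟨ sumFrom-cong 0 (suc n) (λ t _ _ → term-recurrence n t) ⟩
    sumFrom 0 (suc n) (λ t → c * (term n t + (certificate n t - certificate n (suc t))))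
      ≡⟨ sumFrom-*ˡ 0 (suc n) _ c ⟩
    c * sumFrom 0 (suc n) (λ t → term n t + (certificate n t - certificate n (suc t)))
      ≡⟨ cong (c *_) (sumFrom-+ 0 (suc n) (term n) _) ⟩
    c * (sumFrom 0 (suc n) (term n) + sumFrom 0 (suc n) (λ t → certificate n t - certificate n (suc t)))
      ≡⟨ cong₂ (λ x y → c * (x + y)) (sumFrom-snoc 0 n (term n)) (sumFrom-telescope 0 (suc n) (certificate n)) ⟩
    c * (rhs n + term n n + (certificate n 0 - certificate n (suc n)))
      ≡⟨ cong₂ (λ x y → c * (rhs n + x + (certificate n 0 - y))) (term-vanishes n n n≤ιn)
                                                                  certificate-vanishes ⟩
    c * (rhs n + 0ℚ + (certificate n 0 - 0ℚ))
      ≡⟨ drop-zeros c (rhs n) (certificate n 0) ⟩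
    c * (rhs n + certificate n 0)
      ∎
    where
    c = qint q (suc n ℕ.+ suc n)
    n≤ιn : n ≤ ι n
    n≤ιn = subst (n ≤_) split (ℕP.m≤n+m n (d ℕ.+ n))
      where split : suc dd ℕ.+ n ℕ.+ n ≡ suc dd ℕ.+ 2 ℕ.* n
            split = solve (n ∷ dd ∷ [])
    n<ι[1+n] : n < ι (suc n)
    n<ι[1+n] = subst (n <_) split (ℕP.m<n+m n (s≤s (z≤n {suc (d ℕ.+ n)})))
      where split : suc (suc (suc dd ℕ.+ n)) ℕ.+ n ≡ suc dd ℕ.+ 2 ℕ.* suc n
            split = solve (n ∷ dd ∷ [])
    certificate-vanishes : certificate n (suc n) ≡ 0ℚ
    certificate-vanishes = *-zeroʳ-≡ (certificate-weight n (suc n)) (gauss-2n-above n n<ι[1+n])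
    drop-zeros : ∀ c x y → c * (x + 0ℚ + (y - 0ℚ)) ≡ c * (x + y)
    drop-zeros = solve-∀ ℚ-ring

  lhs : ℕ → ℚ
  lhs n = sumFrom 1 (n ∸ 1) (summand n)

  Invariant : ℕ → Set
  Invariant n = qint q d * qint q n * lhs n ≡ rhs n

  invariant-base : Invariant d
  invariant-base = begin
    qint q d * qint q d * lhs d  ≡⟨ cong (qint q d * qint q d *_) lhs≡0 ⟩
    qint q d * qint q d * 0ℚ     ≡⟨ ℚP.*-zeroʳ (qint q d * qint q d) ⟩
    0ℚ                           ≡⟨ sym rhs≡0 ⟩
    rhs d                        ∎
    where
    lhs≡0 : lhs d ≡ 0ℚ
    lhs≡0 = sumFrom-zero 1 dd (summand d) λ k _ k<d → summand-below d k k<d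
    rhs≡0 : rhs d ≡ 0ℚ
    rhs≡0 = sumFrom-zero 0 d (term d) λ t _ _ → term-vanishes d t (ℕP.m≤m+n d (2 ℕ.* t))

  certificate-at-0 : ∀ n → certificate n 0 ≡ q ^ n * qint q d * gauss-2n n d
  certificate-at-0 n = begin
    1ℚ * q ^ (3 ℕ.* 0 ℕ.* 0 ℕ.+ 3 ℕ.* dd ℕ.* 0 ℕ.+ 2 ℕ.* 0 ℕ.+ n) * qint q (ι 0) * gauss-2n n (ι 0)
      ≡⟨ cong₂ (λ e m → 1ℚ * q ^ e * qint q m * gauss-2n n m) exponent ι0≡d ⟩
    1ℚ * q ^ n * qint q d * gauss-2n n d
      ≡⟨ unit (q ^ n) (qint q d) (gauss-2n n d) ⟩
    q ^ n * qint q d * gauss-2n n d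
      ∎
    where
    exponent : 3 ℕ.* 0 ℕ.* 0 ℕ.+ 3 ℕ.* dd ℕ.* 0 ℕ.+ 2 ℕ.* 0 ℕ.+ n ≡ n
    exponent = solve (dd ∷ n ∷ [])
    ι0≡d : ι 0 ≡ d
    ι0≡d = ℕP.+-identityʳ d
    unit : ∀ a b c → 1ℚ * a * b * c ≡ a * b * c
    unit = solve-∀ ℚ-ring

  invariant-step : ∀ n → Invariant (suc n) → Invariant (suc (suc n))
  invariant-step n invariant = *-cancelˡ (qint≢0 n) (begin
    [N] * ([d] * [N+1] * lhs N₁)
      ≡⟨ cong (λ z → [N] * ([d] * [N+1] * z)) lhs-step ⟩
    [N] * ([d] * [N+1] * ((lhs N + summand N N) * c))
      ≡⟨ expand [N] [d] [N+1] (lhs N) (summand N N) c ⟩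
    [d] * ([N+1] * c) * ([N] * lhs N) + [d] * ([N+1] * c) * ([N] * summand N N)
      ≡⟨ cong₂ (λ x y → [d] * x * ([N] * lhs N) + [d] * x * y) (qint-double N₁) (summand-diag n) ⟩
    [d] * [2N+2] * ([N] * lhs N) + [d] * [2N+2] * (q ^ N * gauss-2n N d * 1ℚ)
      ≡⟨ collect [d] [2N+2] [N] (lhs N) (q ^ N) (gauss-2n N d) ⟩
    [2N+2] * ([d] * [N] * lhs N + q ^ N * [d] * gauss-2n N d)
      ≡⟨ cong₂ (λ x y → [2N+2] * (x + y)) invariant (sym (certificate-at-0 N)) ⟩
    [2N+2] * (rhs N + certificate N 0)
      ≡⟨ sym (rhs-recurrence N) ⟩
    [N] * rhs N₁
      ∎)
    where
    N = suc n
    N₁ = suc N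
    [N] = qint q N
    [N+1] = qint q N₁
    [d] = qint q d
    c = 1ℚ + q ^ N₁
    [2N+2] = qint q (N₁ ℕ.+ N₁)
    lhs-step : lhs N₁ ≡ (lhs N + summand N N) * c
    lhs-step = trans (sum-summand-suc N c (λ _ → refl)) (cong (_* c) (sumFrom-snoc 1 n (summand N)))
    expand : ∀ [N] [d] [N+1] L f c → [N] * ([d] * [N+1] * ((L + f) * c)) ≡ [d] * ([N+1] * c) * ([N] * L) + [d] * ([N+1] * c) * ([N] * f)
    expand = solve-∀ ℚ-ring
    collect : ∀ [d] [2N+2] [N] L Qn B → [d] * [2N+2] * ([N] * L) + [d] * [2N+2] * (Qn * B * 1ℚ) ≡ [2N+2] * ([d] * [N] * L + Qn * [d] * B)
    collect = solve-∀ ℚ-ring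

  invariant : ∀ m → Invariant (m ℕ.+ d)
  invariant zero    = invariant-base
  invariant (suc m) = subst Invariant (cong suc (sym (ℕP.+-suc m dd)))
                            (invariant-step (m ℕ.+ dd) (subst Invariant (ℕP.+-suc m dd) (invariant m)))

  rhs-summand : ℕ → ℕ → ℚ
  rhs-summand n k = (- 1ℚ) ^ k * q ^ ((3 ℕ.* k ℕ.* k ℕ.+ 3 ℕ.* d ℕ.* k ℕ.+ 2) ∸ (5 ℕ.* k ℕ.+ 2 ℕ.* d))
    * (qint q (2 ℕ.* d ℕ.+ 4 ℕ.* k ∸ 2) ⊘ (qint q d * qint q n))
    * qbinom q (2 ℕ.* n) ((n ℕ.+ 1) ∸ (d ℕ.+ 2 ℕ.* k))

  rhs-summand≡term : ∀ n t → d ≤ n → t < (n ℕ.+ 1 ∸ d) / 2 → qint q n ≢ 0ℚ →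
                     - (qint q d * qint q n * rhs-summand n (suc t)) ≡ term n t
  rhs-summand≡term n t d≤n t<u [n]≢0 = begin
    - (D * ((- 1ℚ * sign t) * q ^ e * (J ⊘ D) * B))
      ≡⟨ regroup D (sign t) (q ^ e) (J ⊘ D) B ⟩
    sign t * q ^ e * ((J ⊘ D) * D) * B
      ≡⟨ cong (λ z → sign t * q ^ e * z * B) (⊘-*-cancelʳ J (*-≢0 (qint≢0 dd) [n]≢0)) ⟩
    sign t * q ^ e * J * B
      ≡⟨ cong₃ (λ x y z → sign t * q ^ x * qint q y * z) exponent index binomial ⟩
    term n t
      ∎
    where
    k = suc t
    D = qint q d * qint q n
    e = (3 ℕ.* k ℕ.* k ℕ.+ 3 ℕ.* d ℕ.* k ℕ.+ 2) ∸ (5 ℕ.* k ℕ.+ 2 ℕ.* d)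
    J = qint q (2 ℕ.* d ℕ.+ 4 ℕ.* k ∸ 2)
    b = (n ℕ.+ 1) ∸ (d ℕ.+ 2 ℕ.* k)
    B = qbinom q (2 ℕ.* n) b
    regroup : ∀ D s p J′ B → - (D * ((- 1ℚ * s) * p * J′ * B)) ≡ s * p * (J′ * D) * B
    regroup = solve-∀ ℚ-ring
    exponent : e ≡ 3 ℕ.* t ℕ.* t ℕ.+ 3 ℕ.* dd ℕ.* t ℕ.+ 4 ℕ.* t ℕ.+ d
    exponent = trans (cong (_∸ (5 ℕ.* k ℕ.+ 2 ℕ.* d)) split) (ℕP.m+n∸m≡n (5 ℕ.* k ℕ.+ 2 ℕ.* d) _)
      where split : 3 ℕ.* suc t ℕ.* suc t ℕ.+ 3 ℕ.* suc dd ℕ.* suc t ℕ.+ 2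
                    ≡ (5 ℕ.* suc t ℕ.+ 2 ℕ.* suc dd) ℕ.+ (3 ℕ.* t ℕ.* t ℕ.+ 3 ℕ.* dd ℕ.* t ℕ.+ 4 ℕ.* t ℕ.+ suc dd)
            split = solve (t ∷ dd ∷ [])
    index : 2 ℕ.* d ℕ.+ 4 ℕ.* k ∸ 2 ≡ suc (ι t) ℕ.+ suc (ι t)
    index = trans (cong (_∸ 2) split) (ℕP.m+n∸m≡n 2 (suc (ι t) ℕ.+ suc (ι t)))
      where split : 2 ℕ.* suc dd ℕ.+ 4 ℕ.* suc t ≡ 2 ℕ.+ (suc (suc dd ℕ.+ 2 ℕ.* t) ℕ.+ suc (suc dd ℕ.+ 2 ℕ.* t))
            split = solve (t ∷ dd ∷ [])
    b+complement≡2n : b ℕ.+ (n ℕ.+ suc (ι t)) ≡ n ℕ.+ n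
    b+complement≡2n = ℕP.suc-injective (begin
      suc (b ℕ.+ (n ℕ.+ suc (ι t)))  ≡⟨ shuffle b ⟩
      n ℕ.+ (b ℕ.+ (d ℕ.+ 2 ℕ.* k))  ≡⟨ cong (n ℕ.+_) (ℕP.m∸n+n≡m (half-gap-< (ℕP.≤-trans d≤n (ℕP.m≤m+n n 1)) t<u)) ⟩
      n ℕ.+ (n ℕ.+ 1)                ≡⟨ trans (cong (n ℕ.+_) (ℕP.+-comm n 1)) (ℕP.+-suc n n) ⟩
      suc (n ℕ.+ n)                  ∎)
      where shuffle : ∀ b → suc (b ℕ.+ (n ℕ.+ suc (suc dd ℕ.+ 2 ℕ.* t))) ≡ n ℕ.+ (b ℕ.+ (suc dd ℕ.+ 2 ℕ.* suc t))
            shuffle b = solve (b ∷ n ∷ t ∷ dd ∷ [])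
    binomial : B ≡ gauss-2n n (suc (ι t))
    binomial = begin
      qbinom q (2 ℕ.* n) b               ≡⟨ qbinom≡gauss (2 ℕ.* n) b ⟩
      gauss (2 ℕ.* n) b                  ≡⟨ cong (λ N → gauss N b) (trans (cong (n ℕ.+_) (ℕP.+-identityʳ n)) (sym b+complement≡2n)) ⟩
      gauss (b ℕ.+ (n ℕ.+ suc (ι t))) b  ≡⟨ gauss-sym b (n ℕ.+ suc (ι t)) ⟩
      gauss (b ℕ.+ (n ℕ.+ suc (ι t))) (n ℕ.+ suc (ι t)) ≡⟨ cong (λ N → gauss N (n ℕ.+ suc (ι t))) b+complement≡2n ⟩
      gauss-2n n (suc (ι t))             ∎

  first-identity : ∀ n → d ≤ n → lhs n ≡ - sumFrom 1 ((n ℕ.+ 1 ∸ d) / 2) (rhs-summand n)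
  first-identity n@(suc n′) d≤n = *-cancelˡ D≢0 (trans invariantₙ (sym rhs-as-sum))
    where
    D = qint q d * qint q n
    D≢0 = *-≢0 (qint≢0 dd) (qint≢0 n′)
    u = (n ℕ.+ 1 ∸ d) / 2
    d≤n+1 = ℕP.≤-trans d≤n (ℕP.m≤m+n n 1)
    invariantₙ : D * lhs n ≡ rhs n
    invariantₙ = subst Invariant (ℕP.m∸n+n≡m d≤n) (invariant (n ∸ d))
    u≤n : u ≤ n
    u≤n = ℕP.≤-trans (m/n≤m (n ℕ.+ 1 ∸ d) 2) (ℕP.≤-trans (ℕP.∸-monoʳ-≤ (n ℕ.+ 1) (s≤s (z≤n {dd}))) (ℕP.≤-reflexive (ℕP.m+n∸n≡m n 1)))
    rhs-as-sum : D * (- sumFrom 1 u (rhs-summand n)) ≡ rhs n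
    rhs-as-sum = begin
      D * (- sumFrom 1 u (rhs-summand n))             ≡⟨ ℚP.neg-distribʳ-* D _ ⟨
      - (D * sumFrom 1 u (rhs-summand n))             ≡⟨ cong -_ (sumFrom-*ˡ 1 u (rhs-summand n) D) ⟨
      - sumFrom 1 u (λ k → D * rhs-summand n k)       ≡⟨ sumFrom-neg 1 u _ ⟨
      sumFrom 1 u (λ k → - (D * rhs-summand n k))     ≡⟨ sumFrom-shift 0 u _ ⟩
      sumFrom 0 u (λ t → - (D * rhs-summand n (suc t))) ≡⟨ sumFrom-cong 0 u (λ t _ t<u → rhs-summand≡term n t d≤n t<u (qint≢0 n′)) ⟩
      sumFrom 0 u (term n)                            ≡⟨ sumFrom-pad 0 u (n ∸ u) (term n) beyond ⟨
      sumFrom 0 (u ℕ.+ (n ∸ u)) (term n)              ≡⟨ cong (λ m → sumFrom 0 m (term n)) (ℕP.m+[n∸m]≡n u≤n) ⟩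
      rhs n                                           ∎
      where beyond : ∀ t → u ≤ t → term n t ≡ 0ℚ
            beyond t u≤t = term-vanishes n t (ℕP.≤-pred (subst (_≤ suc (ι t)) (ℕP.+-comm n 1) (half-gap-≥ d≤n+1 u≤t)))

module SecondIdentity (q : ℚ) (q≢1 : q ≢ 1ℚ) (q≢-1 : q ≢ - 1ℚ) (dd : ℕ) where

  open Recurrences q q≢1 q≢-1

  d : ℕ
  d = suc dd

  open Summands q q≢1 q≢-1 d (λ P → P * P)

  exponent : ℕ → ℕ
  exponent k = suc k C 2 ∸ d C 2

  exponent-suc : ∀ k → dd ≤ k → exponent (suc k) ≡ exponent k ℕ.+ suc k
  exponent-suc k dd≤k = trans (cong (_∸ d C 2) ([2+k]C2≡[1+k]C2+[1+k] k)) (ℕP.+-∸-comm (suc k) ([1+k]C2-mono dd≤k))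

  term : ℕ → ℕ → ℚ
  term n k = q ^ exponent k * gauss-2n+1 n (suc k)

  difference : ℕ → ℕ → ℚ
  difference n k = term n k - term n (suc k)

  term-recurrence-from : ∀ t r → dd ≤ t → let n = t ℕ.+ r in
    term (suc n) (suc t) ≡ (1ℚ + q ^ suc n) * (1ℚ + q ^ suc n) * term n (suc t) + q ^ suc n * (difference n t - difference n (suc t))
  term-recurrence-from t r dd≤t = begin
    q ^ exponent (suc t) * g₁
      ≡⟨ cong (_* g₁) step₁ ⟩
    q^e * q^[t+1] * g₁
      ≡⟨ ℚP.*-assoc q^e q^[t+1] g₁ ⟩
    q^e * (q^[t+1] * g₁)
      ≡⟨ cong (q^e *_) (gauss-2n+1-recurrence t r) ⟩
    q^e * ((1ℚ + q^[n+1] * q^[n+1]) * (q^[t+1] * g₂) + q^[n+1] * (g₃ + q^[t+1] * q^[t+2] * g₄))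
      ≡⟨ telescope q^e q^[t+1] q^[t+2] q^[n+1] g₂ g₃ g₄ ⟩
    (1ℚ + q^[n+1]) * (1ℚ + q^[n+1]) * (q^e * q^[t+1] * g₂) + q^[n+1] * ((q^e * g₃ - q^e * q^[t+1] * g₂) - (q^e * q^[t+1] * g₂ - q^e * q^[t+1] * q^[t+2] * g₄))
      ≡⟨ cong₂ (λ y z → (1ℚ + q^[n+1]) * (1ℚ + q^[n+1]) * (y * g₂) + q^[n+1] * ((q^e * g₃ - y * g₂) - (y * g₂ - z * g₄))) (sym step₁) (sym step₂) ⟩
    (1ℚ + q^[n+1]) * (1ℚ + q^[n+1]) * term n (suc t) + q^[n+1] * (difference n t - difference n (suc t))
      ∎
    where
    n = t ℕ.+ r
    q^e = q ^ exponent t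
    q^[t+1] = q ^ suc t
    q^[t+2] = q ^ suc (suc t)
    q^[n+1] = q ^ suc n
    g₁ = gauss-2n+1 (suc n) (suc (suc t))
    g₂ = gauss-2n+1 n (suc (suc t))
    g₃ = gauss-2n+1 n (suc t)
    g₄ = gauss-2n+1 n (suc (suc (suc t)))
    step₁ : q ^ exponent (suc t) ≡ q^e * q^[t+1]
    step₁ = trans (cong (q ^_) (exponent-suc t dd≤t)) (^-+ q (exponent t) (suc t))
    step₂ : q ^ exponent (suc (suc t)) ≡ q^e * q^[t+1] * q^[t+2]
    step₂ = trans (cong (q ^_) (exponent-suc (suc t) (ℕP.m≤n⇒m≤1+n dd≤t)))
                  (trans (^-+ q (exponent (suc t)) (suc (suc t))) (cong (_* q^[t+2]) step₁))
    telescope : ∀ q^e a b c g₂ g₃ g₄ → q^e * ((1ℚ + c * c) * (a * g₂) + c * (g₃ + a * b * g₄))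
                ≡ (1ℚ + c) * (1ℚ + c) * (q^e * a * g₂) + c * ((q^e * g₃ - q^e * a * g₂) - (q^e * a * g₂ - q^e * a * b * g₄))
    telescope = solve-∀ ℚ-ring

  term-vanishes : ∀ n k → n < k → term n k ≡ 0ℚ
  term-vanishes n k n<k = *-zeroʳ-≡ (q ^ exponent k) (gauss-2n+1-above n (s≤s n<k))

  term-recurrence : ∀ n t → dd ≤ t →
    term (suc n) (suc t) ≡ (1ℚ + q ^ suc n) * (1ℚ + q ^ suc n) * term n (suc t) + q ^ suc n * (difference n t - difference n (suc t))
  term-recurrence n t dd≤t with n ℕ.<? t
  ... | no n≮t = subst (λ m → term (suc m) (suc t) ≡ (1ℚ + q ^ suc m) * (1ℚ + q ^ suc m) * term m (suc t)
                                                     + q ^ suc m * (difference m t - difference m (suc t)))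
                       (ℕP.m+[n∸m]≡n (ℕP.≮⇒≥ n≮t)) (term-recurrence-from t (n ∸ t) dd≤t)
  ... | yes n<t = begin
    term (suc n) (suc t)
      ≡⟨ term-vanishes (suc n) (suc t) (s≤s n<t) ⟩
    0ℚ
      ≡⟨ vanish c (q ^ suc n) ⟩
    c * 0ℚ + q ^ suc n * ((0ℚ - 0ℚ) - (0ℚ - 0ℚ))
      ≡⟨ cong₃ (λ x y z → c * x + q ^ suc n * ((y - x) - (x - z))) (sym vanishes₁) (sym vanishes₀) (sym vanishes₂) ⟩
    c * term n (suc t) + q ^ suc n * (difference n t - difference n (suc t))
      ∎
    where
    c = (1ℚ + q ^ suc n) * (1ℚ + q ^ suc n)
    vanishes₀ = term-vanishes n t n<t
    vanishes₁ = term-vanishes n (suc t) (ℕP.m<n⇒m<1+n n<t)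
    vanishes₂ = term-vanishes n (suc (suc t)) (ℕP.m<n⇒m<1+n (ℕP.m<n⇒m<1+n n<t))
    vanish : ∀ c p → 0ℚ ≡ c * 0ℚ + p * ((0ℚ - 0ℚ) - (0ℚ - 0ℚ))
    vanish = solve-∀ ℚ-ring

  rhs : ℕ → ℚ
  rhs n = sumFrom d (suc n) (term n)

  rhs-recurrence : ∀ n → rhs (suc n) ≡ (1ℚ + q ^ suc n) * (1ℚ + q ^ suc n) * rhs n + q ^ suc n * difference n dd
  rhs-recurrence n = begin
    sumFrom d (2 ℕ.+ n) (term (suc n))
      ≡⟨ sumFrom-shift dd (2 ℕ.+ n) (term (suc n)) ⟩
    sumFrom dd (2 ℕ.+ n) (λ t → term (suc n) (suc t))
      ≡⟨ sumFrom-cong dd (2 ℕ.+ n) (λ t dd≤t _ → term-recurrence n t dd≤t) ⟩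
    sumFrom dd (2 ℕ.+ n) (λ t → c * term n (suc t) + p * (difference n t - difference n (suc t)))
      ≡⟨ sumFrom-+ dd (2 ℕ.+ n) (λ t → c * term n (suc t)) (λ t → p * (difference n t - difference n (suc t))) ⟩
    sumFrom dd (2 ℕ.+ n) (λ t → c * term n (suc t)) + sumFrom dd (2 ℕ.+ n) (λ t → p * (difference n t - difference n (suc t)))
      ≡⟨ cong₂ _+_ (sumFrom-*ˡ dd (2 ℕ.+ n) (λ t → term n (suc t)) c) (sumFrom-*ˡ dd (2 ℕ.+ n) (λ t → difference n t - difference n (suc t)) p) ⟩
    c * sumFrom dd (2 ℕ.+ n) (λ t → term n (suc t)) + p * sumFrom dd (2 ℕ.+ n) (λ t → difference n t - difference n (suc t))
      ≡⟨ cong₂ (λ x y → c * x + p * y) (sym (sumFrom-shift dd (2 ℕ.+ n) (term n))) (sumFrom-telescope dd (2 ℕ.+ n) (difference n)) ⟩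
    c * sumFrom d (2 ℕ.+ n) (term n) + p * (difference n dd - difference n (dd ℕ.+ (2 ℕ.+ n)))
      ≡⟨ cong (λ x → c * x + p * (difference n dd - difference n (dd ℕ.+ (2 ℕ.+ n)))) (sumFrom-snoc d (suc n) (term n)) ⟩
    c * (rhs n + term n (d ℕ.+ suc n)) + p * (difference n dd - difference n (dd ℕ.+ (2 ℕ.+ n)))
      ≡⟨ cong₂ (λ x y → c * (rhs n + x) + p * (difference n dd - y)) (term-vanishes n _ n<d+1+n) difference-vanishes ⟩
    c * (rhs n + 0ℚ) + p * (difference n dd - 0ℚ)
      ≡⟨ drop-zeros c (rhs n) p (difference n dd) ⟩
    c * rhs n + p * difference n dd
      ∎
    where
    c = (1ℚ + q ^ suc n) * (1ℚ + q ^ suc n)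
    p = q ^ suc n
    n<d+1+n : n < d ℕ.+ suc n
    n<d+1+n = ℕP.m≤n+m (suc n) d
    n<dd+2+n : n < dd ℕ.+ (2 ℕ.+ n)
    n<dd+2+n = ℕP.<-≤-trans (ℕP.m<n⇒m<1+n (ℕP.n<1+n n)) (ℕP.m≤n+m (2 ℕ.+ n) dd)
    difference-vanishes : difference n (dd ℕ.+ (2 ℕ.+ n)) ≡ 0ℚ
    difference-vanishes = begin
      term n (dd ℕ.+ (2 ℕ.+ n)) - term n (suc (dd ℕ.+ (2 ℕ.+ n)))
        ≡⟨ cong₂ _-_ (term-vanishes n _ n<dd+2+n) (term-vanishes n _ (ℕP.m<n⇒m<1+n n<dd+2+n)) ⟩
      0ℚ - 0ℚ
        ≡⟨ ℚP.+-inverseʳ 0ℚ ⟩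
      0ℚ
        ∎
    drop-zeros : ∀ c s p h → c * (s + 0ℚ) + p * (h - 0ℚ) ≡ c * s + p * h
    drop-zeros = solve-∀ ℚ-ring

  last-summand : ∀ n → qint q d * summand (suc n) (suc n) ≡ q ^ suc n * difference n dd
  last-summand n = *-cancelˡ (qint≢0 n) (begin
    [n+1] * ([d] * summand (suc n) (suc n))      ≡⟨ swap [n+1] [d] _ ⟩
    [d] * ([n+1] * summand (suc n) (suc n))      ≡⟨ cong ([d] *_) (summand-diag n) ⟩
    [d] * (q ^ suc n * g₃ * (1ℚ * 1ℚ))         ≡⟨ regroup [d] (q ^ suc n) g₃ ⟩
    q ^ suc n * ([d] * g₃)                     ≡⟨ cong (q ^ suc n *_) (sym (gauss-2n+1-difference d n)) ⟩
    q ^ suc n * ([n+1] * (g₁ - q ^ d * g₂))     ≡⟨ distribute [n+1] (q ^ suc n) g₁ (q ^ d) g₂ ⟩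
    [n+1] * (q ^ suc n * (1ℚ * g₁ - q ^ d * g₂)) ≡⟨ cong₂ (λ a b → [n+1] * (q ^ suc n * (a * g₁ - b * g₂))) (sym q^exponent-dd) (sym q^exponent-d) ⟩
    [n+1] * (q ^ suc n * difference n dd)       ∎)
    where
    [n+1] = qint q (suc n)
    [d] = qint q d
    g₁ = gauss-2n+1 n d
    g₂ = gauss-2n+1 n (suc d)
    g₃ = gauss-2n (suc n) d
    exponent-dd : exponent dd ≡ 0
    exponent-dd = ℕP.n∸n≡0 (d C 2)
    q^exponent-dd : q ^ exponent dd ≡ 1ℚ
    q^exponent-dd = cong (q ^_) exponent-dd
    q^exponent-d : q ^ exponent d ≡ q ^ d
    q^exponent-d = cong (q ^_) (trans (exponent-suc dd ℕP.≤-refl) (cong (ℕ._+ d) exponent-dd))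
    swap : ∀ a b c → a * (b * c) ≡ b * (a * c)
    swap = solve-∀ ℚ-ring
    regroup : ∀ L p g → L * (p * g * (1ℚ * 1ℚ)) ≡ p * (L * g)
    regroup = solve-∀ ℚ-ring
    distribute : ∀ I p g₁ pd g₂ → p * (I * (g₁ - pd * g₂)) ≡ I * (p * (1ℚ * g₁ - pd * g₂))
    distribute = solve-∀ ℚ-ring

  lhs : ℕ → ℚ
  lhs n = sumFrom 1 n (summand n)

  Invariant : ℕ → Set
  Invariant n = qint q d * lhs n ≡ rhs n

  invariant-base : Invariant dd
  invariant-base = begin
    qint q d * lhs dd  ≡⟨ *-zeroʳ-≡ (qint q d) (sumFrom-zero 1 dd (summand dd) λ k _ k<d → summand-below dd k k<d) ⟩
    0ℚ                 ≡⟨ sumFrom-zero d d (term dd) (λ k d≤k _ → term-vanishes dd k (ℕP.<-≤-trans (ℕP.n<1+n dd) d≤k)) ⟨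
    rhs dd             ∎

  invariant-step : ∀ n → Invariant n → Invariant (suc n)
  invariant-step n invariant = begin
    [d] * sumFrom 1 (suc n) (summand (suc n))
      ≡⟨ cong ([d] *_) (sumFrom-snoc 1 n (summand (suc n))) ⟩
    [d] * (sumFrom 1 n (summand (suc n)) + summand (suc n) (suc n))
      ≡⟨ cong (λ z → [d] * (z + summand (suc n) (suc n))) (sum-summand-suc n c² (λ x → square-product x c)) ⟩
    [d] * (lhs n * c² + summand (suc n) (suc n))
      ≡⟨ distribute [d] (lhs n) c² (summand (suc n) (suc n)) ⟩
    c² * ([d] * lhs n) + [d] * summand (suc n) (suc n)
      ≡⟨ cong₂ (λ a b → c² * a + b) invariant (last-summand n) ⟩
    c² * rhs n + q ^ suc n * difference n dd
      ≡⟨ sym (rhs-recurrence n) ⟩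
    rhs (suc n)
      ∎
    where
    [d] = qint q d
    c = 1ℚ + q ^ suc n
    c² = c * c
    square-product : ∀ x c → x * c * (x * c) ≡ x * x * (c * c)
    square-product = solve-∀ ℚ-ring
    distribute : ∀ L s c f → L * (s * c + f) ≡ c * (L * s) + L * f
    distribute = solve-∀ ℚ-ring

  invariant : ∀ m → Invariant (m ℕ.+ dd)
  invariant zero    = invariant-base
  invariant (suc m) = invariant-step (m ℕ.+ dd) (invariant m)

  rhs-summand : ℕ → ℕ → ℚ
  rhs-summand n k = q ^ exponent k * (1ℚ ⊘ qint q d) * qbinom q (2 ℕ.* n ℕ.+ 1) (n ∸ k)

  rhs-summand≡term : ∀ n k → k ≤ n → qint q d * rhs-summand n k ≡ term n k
  rhs-summand≡term n k k≤n = begin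
    [d] * (q ^ exponent k * (1ℚ ⊘ [d]) * B)  ≡⟨ regroup [d] (q ^ exponent k) (1ℚ ⊘ [d]) B ⟩
    q ^ exponent k * ((1ℚ ⊘ [d]) * [d]) * B  ≡⟨ cong (λ z → q ^ exponent k * z * B) (⊘-*-cancelʳ 1ℚ (qint≢0 dd)) ⟩
    q ^ exponent k * 1ℚ * B                ≡⟨ cong (_* B) (ℚP.*-identityʳ (q ^ exponent k)) ⟩
    q ^ exponent k * B                     ≡⟨ cong (q ^ exponent k *_) binomial ⟩
    term n k                               ∎
    where
    [d] = qint q d
    B = qbinom q (2 ℕ.* n ℕ.+ 1) (n ∸ k)
    regroup : ∀ L a u B → L * (a * u * B) ≡ a * (u * L) * B
    regroup = solve-∀ ℚ-ring
    sizes : (n ∸ k) ℕ.+ (n ℕ.+ suc k) ≡ suc (n ℕ.+ n)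
    sizes = trans (shuffle (n ∸ k)) (trans (cong (λ m → n ℕ.+ suc m) (ℕP.m∸n+n≡m k≤n)) (ℕP.+-suc n n))
      where shuffle : ∀ c → c ℕ.+ (n ℕ.+ suc k) ≡ n ℕ.+ suc (c ℕ.+ k)
            shuffle c = solve (c ∷ n ∷ k ∷ [])
    odd : 2 ℕ.* n ℕ.+ 1 ≡ suc (n ℕ.+ n)
    odd = solve (n ∷ [])
    binomial : B ≡ gauss-2n+1 n (suc k)
    binomial = begin
      qbinom q (2 ℕ.* n ℕ.+ 1) (n ∸ k)  ≡⟨ qbinom≡gauss _ (n ∸ k) ⟩
      gauss (2 ℕ.* n ℕ.+ 1) (n ∸ k)     ≡⟨ cong (λ N → gauss N (n ∸ k)) (trans odd (sym sizes)) ⟩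
      gauss ((n ∸ k) ℕ.+ (n ℕ.+ suc k)) (n ∸ k) ≡⟨ gauss-sym (n ∸ k) (n ℕ.+ suc k) ⟩
      gauss ((n ∸ k) ℕ.+ (n ℕ.+ suc k)) (n ℕ.+ suc k) ≡⟨ cong (λ N → gauss N (n ℕ.+ suc k)) sizes ⟩
      gauss-2n+1 n (suc k)              ∎

  second-identity : ∀ n → d ≤ n → lhs n ≡ sumFrom d (n ∸ d) (rhs-summand n) + q ^ exponent n ⊘ qint q d
  second-identity n d≤n = *-cancelˡ (qint≢0 dd) (begin
    [d] * lhs n
      ≡⟨ subst Invariant (ℕP.m∸n+n≡m (ℕP.≤-trans (ℕP.n≤1+n dd) d≤n)) (invariant (n ∸ dd)) ⟩
    rhs n
      ≡⟨ rhs-split ⟩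
    sumFrom d (n ∸ d) (term n) + term n n
      ≡⟨ cong₂ _+_ (sumFrom-cong d (n ∸ d) λ k _ k<n → sym (rhs-summand≡term n k (ℕP.<⇒≤ (subst (k <_) (ℕP.m+[n∸m]≡n d≤n) k<n))))
                   (sym last-term) ⟩
    sumFrom d (n ∸ d) (λ k → [d] * rhs-summand n k) + [d] * (q ^ exponent n ⊘ [d])
      ≡⟨ cong (_+ [d] * (q ^ exponent n ⊘ [d])) (sumFrom-*ˡ d (n ∸ d) (rhs-summand n) [d]) ⟩
    [d] * sumFrom d (n ∸ d) (rhs-summand n) + [d] * (q ^ exponent n ⊘ [d])
      ≡⟨ ℚP.*-distribˡ-+ [d] _ _ ⟨
    [d] * (sumFrom d (n ∸ d) (rhs-summand n) + q ^ exponent n ⊘ [d])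
      ∎)
    where
    [d] = qint q d
    last-term : [d] * (q ^ exponent n ⊘ [d]) ≡ term n n
    last-term = begin
      [d] * (q ^ exponent n ⊘ [d])      ≡⟨ ℚP.*-comm [d] _ ⟩
      (q ^ exponent n ⊘ [d]) * [d]      ≡⟨ ⊘-*-cancelʳ (q ^ exponent n) (qint≢0 dd) ⟩
      q ^ exponent n                  ≡⟨ ℚP.*-identityʳ (q ^ exponent n) ⟨
      q ^ exponent n * 1ℚ             ≡⟨ cong (q ^ exponent n *_) (gauss-2n+1-diag n) ⟨
      term n n                        ∎
    rhs-split : rhs n ≡ sumFrom d (n ∸ d) (term n) + term n n
    rhs-split = begin
      sumFrom d (suc n) (term n)                       ≡⟨ cong (λ m → sumFrom d m (term n)) (cong suc (ℕP.m∸n+n≡m d≤n)) ⟨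
      sumFrom d (suc (n ∸ d) ℕ.+ d) (term n)           ≡⟨ sumFrom-pad d (suc (n ∸ d)) d (term n) beyond ⟩
      sumFrom d (suc (n ∸ d)) (term n)                 ≡⟨ sumFrom-snoc d (n ∸ d) (term n) ⟩
      sumFrom d (n ∸ d) (term n) + term n (d ℕ.+ (n ∸ d)) ≡⟨ cong (λ k → sumFrom d (n ∸ d) (term n) + term n k) (ℕP.m+[n∸m]≡n d≤n) ⟩
      sumFrom d (n ∸ d) (term n) + term n n            ∎
      where beyond : ∀ k → d ℕ.+ suc (n ∸ d) ≤ k → term n k ≡ 0ℚ
            beyond k le = term-vanishes n k (ℕP.<-≤-trans (s≤s (ℕP.≤-reflexive (sym (ℕP.m+[n∸m]≡n d≤n)))) (ℕP.≤-trans (ℕP.≤-reflexive (sym (ℕP.+-suc d (n ∸ d)))) le))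

theorem1p2 : (n d : ℕ) → 1 ≤ n → 1 ≤ d → d ≤ n ∸ 1 →
    (q : ℚ) → q ≢ 1ℚ → q ≢ - 1ℚ →
    (Σ[ 1 to n ∸ 1 ] (λ k → q ^ k * qbinom q (2 ℕ.* k) (k ℕ.+ d) * qpoch (- (q ^ suc k)) q (n ∸ k) ⊘ qint q k)
      ≡ - Σ[ 1 to (n ℕ.+ 1 ∸ d) / 2 ] (λ k → (- 1ℚ) ^ k * q ^ ((3 ℕ.* k ℕ.* k ℕ.+ 3 ℕ.* d ℕ.* k ℕ.+ 2) ∸ (5 ℕ.* k ℕ.+ 2 ℕ.* d))
          * (qint q (2 ℕ.* d ℕ.+ 4 ℕ.* k ∸ 2) ⊘ (qint q d * qint q n))
          * qbinom q (2 ℕ.* n) ((n ℕ.+ 1) ∸ (d ℕ.+ 2 ℕ.* k))))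
    ×
    (Σ[ 1 to n ] (λ k → q ^ k * qbinom q (2 ℕ.* k) (k ℕ.+ d) * (qpoch (- (q ^ suc k)) q (n ∸ k) * qpoch (- (q ^ suc k)) q (n ∸ k)) ⊘ qint q k)
      ≡ Σ[ d to n ∸ 1 ] (λ k → q ^ (suc k C 2 ∸ d C 2) * (1ℚ ⊘ qint q d) * qbinom q (2 ℕ.* n ℕ.+ 1) (n ∸ k))
        + q ^ (suc n C 2 ∸ d C 2) ⊘ qint q d)
theorem1p2 n@(suc _) (suc dd) _ _ d≤n-1 q q≢1 q≢-1 =
  FirstIdentity.first-identity q q≢1 q≢-1 dd n d≤n ,
  SecondIdentity.second-identity q q≢1 q≢-1 dd n d≤n
  where d≤n = ℕP.m≤n⇒m≤1+n d≤n-1
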